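{- Let $S\subset\mathbb{P}^4_{\mathbb{Q}}$ be defined by $x_0x_3-x_1x_4=0$, $x_0x_1+x_1x_3+x_2^2=0$, let $S^\circ=\{\mathbf{x}\in S:x_1\neq0\}$, and for $\mathbf{x}\in S(\mathbb{Q})$ with primitive integer representative $(x_0,\dots,x_4)$ let $H(\mathbf{x})=\max_j|x_j|$. For $\boldsymbol\eta=(\eta_1,\dots,\eta_6)\in\mathbb{Z}_{>0}^6$ and $\boldsymbol\alpha=(\alpha_1,\alpha_2,\alpha_3)\in\mathbb{Z}^3$ put \[\Psi(\boldsymbol\eta,\boldsymbol\alpha)=\big(\eta_1^2\eta_2\eta_3^2\eta_4\eta_5^2\alpha_2,\ \eta_1^4\eta_2^2\eta_3^3\eta_4^3\eta_5^2\eta_6^2,\ \eta_1^3\eta_2^2\eta_3^2\eta_4^2\eta_5\eta_6\alpha_1,\ \eta_1^2\eta_2\eta_3\eta_4^2\eta_6^2\alpha_3,\ \alpha_2\alpha_3\big).\] Fix $B>0$ and let $\mathcal{T}_1$ be the set of $(\boldsymbol\eta,\boldsymbol\alpha)\in\mathbb{Z}_{>0}^6\times\mathbb{Z}^3$ such that: (i) $\eta_2\alpha_1^2+\eta_3\eta_5^2\alpha_2+\eta_4\eta_6^2\alpha_3=0$; (ii) $\gcd(\eta_i,\eta_j)=1$ for all $i\neq j$ with $\{i,j\}\notin\{\{1,2\},\{1,3\},\{1,4\},\{3,5\},\{4,6\}\}$; (iii) $\gcd(\alpha_1,\eta_1\eta_3\eta_4\eta_5\eta_6)=1$, $\gcd(\alpha_2,\eta_1\eta_2\eta_3\eta_4\eta_6)=1$,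 $\gcd(\alpha_3,\eta_1\eta_2\eta_3\eta_4\eta_5)=1$; (iv) each of the five coordinates of $\Psi(\boldsymbol\eta,\boldsymbol\alpha)$ has absolute value at most $B$. Then $(\boldsymbol\eta,\boldsymbol\alpha)\mapsto(\Psi(\boldsymbol\eta,\boldsymbol\alpha)_0:\dots:\Psi(\boldsymbol\eta,\boldsymbol\alpha)_4)$ defines a bijection between $\mathcal{T}_1$ and the set $\{\mathbf{x}\in S^\circ(\mathbb{Q}):H(\mathbf{x})\le B\}$.
   Context: The paper phrases the height condition (iv) in the equivalent rescaled form: with $X_0=(\eta_1^4\eta_2^2\eta_3^3\eta_4^3\eta_5^2\eta_6^2/B)^{1/3}$, $X_1=(B\eta_1^{ -1}\eta_2^{ -2}\eta_5\eta_6)^{1/3}$, $X_2=(B\eta_1^2\eta_2\eta_4^3\eta_5^{ -2}\eta_6^4)^{1/3}$, the conditions $|X_0^3|\le1$, $|X_0^2\alpha_1/X_1|\le1$, $|X_0^2\alpha_2/X_2|\le1$, $|X_0(X_0\alpha_2/X_2+(\alpha_1/X_1)^2)|\le1$, $|(\alpha_2/X_2)(X_0\alpha_2/X_2+(\alpha_1/X_1)^2)|\le1$, which (using (i) to eliminate $\alpha_3$) are equivalent to (iv).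
   Formalization: The height bound B ranges over the positive rationals. -}

module Defs where

open import Data.Nat as ℕ using (ℕ; zero; suc)
import Data.Nat.GCD as ℕG
open import Data.Integer as ℤ using (ℤ; +_; ∣_∣; 1ℤ; 0ℤ; _^_)
open import Data.Integer.GCD using (gcd)
open import Data.Rational as ℚ using (ℚ; 0ℚ)
open import Data.Vec using (Vec; []; _∷_; map)
open import Data.Product using (_×_; Σ; ∃; _,_)
open import Relation.Binary.PropositionalEquality using (_≡_; _≢_)

toℚ : ℤ → ℚ
toℚ i = i ℚ./ 1

-- Integer vectors representing points of P^4(ℚ): (x0, x1, x2, x3, x4)
Pt : Set
Pt = Vec ℤ 5

NonZeroVec : Pt → Set
NonZeroVec x = x ≢ (0ℤ ∷ 0ℤ ∷ 0ℤ ∷ 0ℤ ∷ 0ℤ ∷ [])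

-- projective equality: x and y are proportional by nonzero scalars
_∼_ : Pt → Pt → Set
x ∼ y = Σ ℤ λ l → Σ ℤ λ m → (l ≢ 0ℤ) × (m ≢ 0ℤ) × (map (l ℤ.*_) x ≡ map (m ℤ.*_) y)

InS : Pt → Set
InS (x0 ∷ x1 ∷ x2 ∷ x3 ∷ x4 ∷ []) =
  (x0 ℤ.* x3 ℤ.- x1 ℤ.* x4 ≡ 0ℤ) × (x0 ℤ.* x1 ℤ.+ x1 ℤ.* x3 ℤ.+ x2 ℤ.* x2 ≡ 0ℤ)

InS° : Pt → Set
InS° x@(x0 ∷ x1 ∷ x2 ∷ x3 ∷ x4 ∷ []) = InS x × (x1 ≢ 0ℤ)

maxAbs : Pt → ℕ
maxAbs (x0 ∷ x1 ∷ x2 ∷ x3 ∷ x4 ∷ []) =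
  ∣ x0 ∣ ℕ.⊔ ∣ x1 ∣ ℕ.⊔ ∣ x2 ∣ ℕ.⊔ ∣ x3 ∣ ℕ.⊔ ∣ x4 ∣

gcdAll : Pt → ℕ
gcdAll (x0 ∷ x1 ∷ x2 ∷ x3 ∷ x4 ∷ []) =
  ℕG.gcd ∣ x0 ∣ (ℕG.gcd ∣ x1 ∣ (ℕG.gcd ∣ x2 ∣ (ℕG.gcd ∣ x3 ∣ ∣ x4 ∣)))

private
  quot : ℕ → ℕ → ℚ
  quot m zero = 0ℚ
  quot m (suc k) = (+ m) ℚ./ suc k

-- Height of the point [x]: max |y_j| for the primitive representative
-- y = x / gcd(x), i.e. max|x_j| / gcd(x_0,...,x_4)   (x nonzero)
H : Pt → ℚ
H x = quot (maxAbs x) (gcdAll x)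

Param : Set
Param = Vec ℤ 6 × Vec ℤ 3

Ψ : Param → Pt
Ψ (e1 ∷ e2 ∷ e3 ∷ e4 ∷ e5 ∷ e6 ∷ [] , a1 ∷ a2 ∷ a3 ∷ []) =
  (e1 ^ 2 ℤ.* e2 ℤ.* e3 ^ 2 ℤ.* e4 ℤ.* e5 ^ 2 ℤ.* a2)
  ∷ (e1 ^ 4 ℤ.* e2 ^ 2 ℤ.* e3 ^ 3 ℤ.* e4 ^ 3 ℤ.* e5 ^ 2 ℤ.* e6 ^ 2)
  ∷ (e1 ^ 3 ℤ.* e2 ^ 2 ℤ.* e3 ^ 2 ℤ.* e4 ^ 2 ℤ.* e5 ℤ.* e6 ℤ.* a1)
  ∷ (e1 ^ 2 ℤ.* e2 ℤ.* e3 ℤ.* e4 ^ 2 ℤ.* e6 ^ 2 ℤ.* a3)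
  ∷ (a2 ℤ.* a3)
  ∷ []


AllAbsLe : Pt → ℚ → Set
AllAbsLe (x0 ∷ x1 ∷ x2 ∷ x3 ∷ x4 ∷ []) B =
  (toℚ (+ ∣ x0 ∣) ℚ.≤ B) × (toℚ (+ ∣ x1 ∣) ℚ.≤ B) × (toℚ (+ ∣ x2 ∣) ℚ.≤ B)
  × (toℚ (+ ∣ x3 ∣) ℚ.≤ B) × (toℚ (+ ∣ x4 ∣) ℚ.≤ B)

Cop : ℤ → ℤ → Set
Cop a b = gcd a b ≡ 1ℤ

InT1 : ℚ → Param → Set
InT1 B t@(e1 ∷ e2 ∷ e3 ∷ e4 ∷ e5 ∷ e6 ∷ [] , a1 ∷ a2 ∷ a3 ∷ []) =
  (0ℤ ℤ.< e1) × (0ℤ ℤ.< e2) × (0ℤ ℤ.< e3) × (0ℤ ℤ.< e4) × (0ℤ ℤ.< e5) × (0ℤ ℤ.< e6)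
  × (e2 ℤ.* a1 ℤ.* a1 ℤ.+ e3 ℤ.* e5 ℤ.* e5 ℤ.* a2 ℤ.+ e4 ℤ.* e6 ℤ.* e6 ℤ.* a3 ≡ 0ℤ)
  × Cop e1 e5 × Cop e1 e6 × Cop e2 e3 × Cop e2 e4 × Cop e2 e5 × Cop e2 e6
  × Cop e3 e4 × Cop e3 e6 × Cop e4 e5 × Cop e5 e6
  × Cop a1 (e1 ℤ.* e3 ℤ.* e4 ℤ.* e5 ℤ.* e6)
  × Cop a2 (e1 ℤ.* e2 ℤ.* e3 ℤ.* e4 ℤ.* e6)
  × Cop a3 (e1 ℤ.* e2 ℤ.* e3 ℤ.* e4 ℤ.* e5)
  × AllAbsLe (Ψ t) B

module Submission where

-- Ψ(η, α) lies on S by the torsor equation (i), its second coordinate N₁ is positive, and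
-- (ii)–(iii) make its coordinates coprime; so proportional values of Ψ are equal, and the
-- height of Ψ(η, α) is its largest coordinate, bounded by (iv).  The parameters are read off
-- Ψ(η, α) by gcds: N₀ = gcd(x₀, x₁), G = gcd(N₀, N₃) with N₀ = U G and N₃ = V G,
-- η₃ = gcd(U, G), η₄ = gcd(V, G), and η₂ = gcd(η₁²η₂, η₂α₁²) since η₂α₁² = |U α₂ + V α₃|.
-- Conversely, write x ∈ S° as l·y with y primitive and y₁ > 0.  The first quadric forces
-- y = (α₂A, CA, y₂, α₃C, α₂α₃) where A = gcd(y₁, y₀); the second one then reads
-- y₂² = g³uvw with A = ug, C = vg and w = -(uα₂ + vα₃) ≥ 0, where u, v, w are pairwise
-- coprime because y is primitive.  Splitting off gcds and using that coprime factors of a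
-- square are squares produces η₁, …, η₆ and α₁.

open import Defs

module Arithmetic where
  open import Data.Nat
  open import Data.Nat.Properties
  open import Data.Nat.Divisibility
  open import Data.Nat.GCD
  open import Data.Nat.Coprimality as C using (Coprime; coprime-divisor)
  open import Data.Product using (Σ-syntax; _×_; _,_)
  open import Relation.Binary.PropositionalEquality
  open import Relation.Binary.Definitions using (tri<; tri≈; tri>)
  open import Relation.Nullary.Negation using (contradiction)
  open import Function.Base using (it)
  import Algebra.Solver.CommutativeMonoid *-1-commutativeMonoid as Monoid
  open Monoid using (solve; _⊜_)

  private variable
    d m n o : ℕ

  infixl 7 _*≢0_
  _*≢0_ : NonZero m → NonZero n → NonZero (m * n)
  _*≢0_ {m} {n} m≢0 n≢0 = m*n≢0 m n {{m≢0}} {{n≢0}}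

  nonZeroˡ : ∀ m → NonZero (m * n) → NonZero m
  nonZeroˡ m mn≢0 = m*n≢0⇒m≢0 m {{mn≢0}}

  -- Expressions for the commutative-monoid solver; x ^ᵉ k unfolds exactly like ℕ._^_, so
  -- the solver's identities can be used for goals stated with powers.
  infixl 7 _·_
  infixr 8 _^ᵉ_
  _·_ : ∀ {k} → Monoid.Expr k → Monoid.Expr k → Monoid.Expr k
  _·_ = Monoid._⊕_
  _^ᵉ_ : ∀ {k} → Monoid.Expr k → ℕ → Monoid.Expr k
  x ^ᵉ zero  = Monoid.id
  x ^ᵉ suc k = x Monoid.⊕ x ^ᵉ k

  coprime-∣ˡ : Coprime m n → d ∣ m → Coprime d n
  coprime-∣ˡ c d∣m (k∣d , k∣n) = c (∣-trans k∣d d∣m , k∣n)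

  coprime-∣ʳ : Coprime m n → d ∣ n → Coprime m d
  coprime-∣ʳ c d∣n (k∣m , k∣d) = c (k∣m , ∣-trans k∣d d∣n)

  coprime-∣ : Coprime m n → d ∣ m → o ∣ n → Coprime d o
  coprime-∣ m⊥n d∣m o∣n = coprime-∣ʳ (coprime-∣ˡ m⊥n d∣m) o∣n

  coprime-*ʳ : Coprime m n → Coprime m o → Coprime m (n * o)
  coprime-*ʳ cmn cmo (k∣m , k∣no) = cmo (k∣m , coprime-divisor (coprime-∣ˡ cmn k∣m) k∣no)

  coprime-*ˡ : Coprime m o → Coprime n o → Coprime (m * n) o
  coprime-*ˡ cmo cno = C.sym (coprime-*ʳ (C.sym cmo) (C.sym cno))

  coprime-^ʳ : ∀ k → Coprime m n → Coprime m (n ^ k)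
  coprime-^ʳ zero    c (_ , k∣1) = ∣1⇒≡1 k∣1
  coprime-^ʳ (suc k) c = coprime-*ʳ c (coprime-^ʳ k c)

  coprime-∣ʳ-^ : ∀ k → Coprime m n → o ∣ n ^ k → Coprime m o
  coprime-∣ʳ-^ k m⊥n o∣nᵏ = coprime-∣ʳ (coprime-^ʳ k m⊥n) o∣nᵏ

  coprime-square : Coprime m n → Coprime (m * m) (n * n)
  coprime-square c = coprime-*ˡ (coprime-*ʳ c c) (coprime-*ʳ c c)

  coprime-∣⇒≡1 : Coprime m n → m ∣ n → m ≡ 1
  coprime-∣⇒≡1 c m∣n = c (∣-refl , m∣n)

  gcd[m*o,n*o]≡o : ∀ o → Coprime m n → gcd (m * o) (n * o) ≡ o
  gcd[m*o,n*o]≡o {m} {n} o c = begin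
    gcd (m * o) (n * o) ≡⟨ cong₂ gcd (*-comm m o) (*-comm n o) ⟩
    gcd (o * m) (o * n) ≡⟨ c*gcd[m,n]≡gcd[cm,cn] o m n ⟨
    o * gcd m n         ≡⟨ cong (o *_) (C.coprime⇒gcd≡1 c) ⟩
    o * 1               ≡⟨ *-identityʳ o ⟩
    o                   ∎
    where open ≡-Reasoning

  -- Opaque, like the other existence lemmas below: Agda would otherwise unfold the gcd
  -- computation when the witnesses are projected, which makes later `with`s blow up.
  opaque
    gcd-factorisation : ∀ m n .{{_ : NonZero m}} →
      Σ[ u ∈ ℕ ] Σ[ v ∈ ℕ ] Σ[ g ∈ ℕ ] Σ[ _ ∈ NonZero g ] m ≡ u * g × n ≡ v * g × Coprime u v
    gcd-factorisation m n with gcd[m,n]∣m m n | gcd[m,n]∣n m n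
    ... | divides u m≡ug | divides v n≡vg = u , v , g , g≢0 , m≡ug , n≡vg , C.gcd≡1⇒coprime gcd[u,v]≡1
      where
      g : ℕ
      g = gcd m n
      g≢0 : NonZero g
      g≢0 = ≢-nonZero (λ g≡0 → ≢-nonZero⁻¹ m (gcd[m,n]≡0⇒m≡0 g≡0))
      gcd[u,v]≡1 : gcd u v ≡ 1
      gcd[u,v]≡1 = *-cancelˡ-≡ (gcd u v) 1 g {{g≢0}} (begin
        g * gcd u v         ≡⟨ c*gcd[m,n]≡gcd[cm,cn] g u v ⟩
        gcd (g * u) (g * v) ≡⟨ cong₂ gcd (*-comm g u) (*-comm g v) ⟩
        gcd (u * g) (v * g) ≡⟨ cong₂ gcd m≡ug n≡vg ⟨
        g                   ≡⟨ *-identityʳ g ⟨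
        g * 1               ∎)
        where open ≡-Reasoning

  m*m≡n*n⇒m≡n : m * m ≡ n * n → m ≡ n
  m*m≡n*n⇒m≡n {m} {n} eq with <-cmp m n
  ... | tri≈ _ m≡n _ = m≡n
  ... | tri< m<n _ _ = contradiction eq (<⇒≢ (*-mono-< m<n m<n))
  ... | tri> _ _ n<m = contradiction (sym eq) (<⇒≢ (*-mono-< n<m n<m))

  gcd[m*m,n*n]≡gcd[m,n]² : ∀ m n → gcd (m * m) (n * n) ≡ gcd m n * gcd m n
  gcd[m*m,n*n]≡gcd[m,n]² zero n =
    trans (gcd-identityˡ (n * n)) (sym (cong₂ _*_ (gcd-identityˡ n) (gcd-identityˡ n)))
  gcd[m*m,n*n]≡gcd[m,n]² m@(suc _) n with gcd-factorisation m n
  ... | u , v , g , _ , m≡ug , n≡vg , c = begin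
    gcd (m * m) (n * n)                     ≡⟨ cong₂ gcd (cong₂ _*_ m≡ug m≡ug) (cong₂ _*_ n≡vg n≡vg) ⟩
    gcd (u * g * (u * g)) (v * g * (v * g)) ≡⟨ cong₂ gcd (regroup u g) (regroup v g) ⟩
    gcd (u * u * (g * g)) (v * v * (g * g)) ≡⟨ gcd[m*o,n*o]≡o (g * g) (coprime-square c) ⟩
    g * g                                   ≡⟨ cong₂ _*_ gcd[m,n]≡g gcd[m,n]≡g ⟨
    gcd m n * gcd m n                       ∎
    where
    open ≡-Reasoning
    regroup : ∀ a b → a * b * (a * b) ≡ a * a * (b * b)
    regroup = solve 2 (λ a b → a · b · (a · b) ⊜ a · a · (b · b)) refl
    gcd[m,n]≡g : gcd m n ≡ g
    gcd[m,n]≡g = trans (cong₂ gcd m≡ug n≡vg) (gcd[m*o,n*o]≡o g c)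

  m∣n⇒gcd[m,n]≡m : m ∣ n → gcd m n ≡ m
  m∣n⇒gcd[m,n]≡m m∣n = ∣-antisym (gcd[m,n]∣m _ _) (gcd-greatest ∣-refl m∣n)

  m*m∣n*n⇒m∣n : m * m ∣ n * n → m ∣ n
  m*m∣n*n⇒m∣n {m} {n} mm∣nn = subst (_∣ n) gcd[m,n]≡m (gcd[m,n]∣n m n)
    where
    gcd[m,n]≡m : gcd m n ≡ m
    gcd[m,n]≡m = m*m≡n*n⇒m≡n (trans (sym (gcd[m*m,n*n]≡gcd[m,n]² m n)) (m∣n⇒gcd[m,n]≡m mm∣nn))

  opaque
    square-quotient : ∀ d {b c} → {{NonZero d}} → d * d * b ≡ c * c →
      Σ[ s ∈ ℕ ] c ≡ d * s × b ≡ s * s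
    square-quotient d {b} {c} eq with m*m∣n*n⇒m∣n (divides b (trans (sym eq) (*-comm (d * d) b)))
    ... | divides s c≡sd = s , trans c≡sd (*-comm s d) , *-cancelˡ-≡ b (s * s) (d * d) {{m*n≢0 d d}} (begin
      d * d * b           ≡⟨ eq ⟩
      c * c               ≡⟨ cong₂ _*_ c≡sd c≡sd ⟩
      s * d * (s * d)     ≡⟨ solve 2 (λ s d → s · d · (s · d) ⊜ d · d · (s · s)) refl s d ⟩
      d * d * (s * s)     ∎)
      where open ≡-Reasoning

    coprime-product-square : ∀ {a b c} → {{NonZero a}} → Coprime a b → a * b ≡ c * c →
      Σ[ r ∈ ℕ ] Σ[ s ∈ ℕ ] a ≡ r * r × b ≡ s * s × c ≡ r * s
    coprime-product-square {a} {b} {c} cab eq =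
      let s , c≡rs , b≡ss = square-quotient r {{r≢0}} (trans (cong (_* b) (sym a≡rr)) eq)
      in r , s , a≡rr , b≡ss , c≡rs
      where
      r : ℕ
      r = gcd a c
      a≡rr : a ≡ r * r
      a≡rr = begin
        a                   ≡⟨ gcd[m*o,n*o]≡o a cab ⟨
        gcd (a * a) (b * a) ≡⟨ cong (gcd (a * a)) (trans (*-comm b a) eq) ⟩
        gcd (a * a) (c * c) ≡⟨ gcd[m*m,n*n]≡gcd[m,n]² a c ⟩
        r * r               ∎
        where open ≡-Reasoning
      r≢0 : NonZero r
      r≢0 = m*n≢0⇒m≢0 r {{subst NonZero a≡rr it}}

module Height where
  open import Data.Nat as ℕ using (ℕ; zero; suc; _⊔_)
  import Data.Nat.Properties as ℕ
  open import Data.Integer as ℤ using (ℤ; +_; ∣_∣)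
  import Data.Integer.Properties as ℤ
  open import Data.Rational using (ℚ; _/_; _≤_)
  import Data.Rational.Properties as ℚ
  open import Data.Rational.Unnormalised using (mkℚᵘ; *≤*)
  import Data.Rational.Unnormalised.Properties as ℚᵘ
  open import Data.Vec using (_∷_; []; map; lookup)
  import Data.Fin as Fin
  open import Data.Sum using (inj₁; inj₂)
  open import Data.Product using (_,_)
  open import Relation.Binary.PropositionalEquality
  open import Relation.Nullary.Negation using (contradiction)
  open import Data.Nat.GCD using (gcd[m,n]≡0⇒m≡0; gcd[m,n]≡0⇒n≡0)

  cross-≤⇒/≤/ : ∀ m n k j → m ℕ.* suc j ℕ.≤ n ℕ.* suc k → + m / suc k ≤ + n / suc j
  cross-≤⇒/≤/ m n k j m[j+1]≤n[k+1] =
    ℚ.toℚᵘ-cancel-≤ (ℚᵘ.≤-respˡ-≃ (ℚᵘ.≃-sym (ℚ.toℚᵘ-fromℚᵘ (mkℚᵘ (+ m) k)))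
      (ℚᵘ.≤-respʳ-≃ (ℚᵘ.≃-sym (ℚ.toℚᵘ-fromℚᵘ (mkℚᵘ (+ n) j))) (*≤* (subst₂ ℤ._≤_
        (ℤ.pos-* m (suc j)) (ℤ.pos-* n (suc k)) (ℤ.+≤+ m[j+1]≤n[k+1])))))

  toℚ-mono-≤ : ∀ {m n} → m ℕ.≤ n → toℚ (+ m) ≤ toℚ (+ n)
  toℚ-mono-≤ {m} {n} m≤n = cross-≤⇒/≤/ m n 0 0 (ℕ.*-monoˡ-≤ 1 m≤n)

  toℚ-⊔-≤ : ∀ {B} m n → toℚ (+ m) ≤ B → toℚ (+ n) ≤ B → toℚ (+ (m ⊔ n)) ≤ B
  toℚ-⊔-≤ m n m≤B n≤B with ℕ.⊔-sel m n
  ... | inj₁ m⊔n≡m rewrite m⊔n≡m = m≤B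
  ... | inj₂ m⊔n≡n rewrite m⊔n≡n = n≤B

  AllAbsLe⇒maxAbs≤ : ∀ {B} x → AllAbsLe x B → toℚ (+ maxAbs x) ≤ B
  AllAbsLe⇒maxAbs≤ (x0 ∷ x1 ∷ x2 ∷ x3 ∷ x4 ∷ []) (≤0 , ≤1 , ≤2 , ≤3 , ≤4) =
    toℚ-⊔-≤ (∣ x0 ∣ ⊔ ∣ x1 ∣ ⊔ ∣ x2 ∣ ⊔ ∣ x3 ∣) ∣ x4 ∣
      (toℚ-⊔-≤ (∣ x0 ∣ ⊔ ∣ x1 ∣ ⊔ ∣ x2 ∣) ∣ x3 ∣
        (toℚ-⊔-≤ (∣ x0 ∣ ⊔ ∣ x1 ∣) ∣ x2 ∣ (toℚ-⊔-≤ ∣ x0 ∣ ∣ x1 ∣ ≤0 ≤1) ≤2) ≤3) ≤4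

  maxAbs≤⇒AllAbsLe : ∀ {B} x → toℚ (+ maxAbs x) ≤ B → AllAbsLe x B
  maxAbs≤⇒AllAbsLe {B} x@(x0 ∷ x1 ∷ x2 ∷ x3 ∷ x4 ∷ []) M≤B =
    ≤B (⊔ʳ (⊔ʳ (⊔ʳ (ℕ.m≤m⊔n a0 a1)))) , ≤B (⊔ʳ (⊔ʳ (⊔ʳ (ℕ.m≤n⊔m a0 a1)))) ,
    ≤B (⊔ʳ (⊔ʳ (ℕ.m≤n⊔m (a0 ⊔ a1) a2))) , ≤B (⊔ʳ (ℕ.m≤n⊔m (a0 ⊔ a1 ⊔ a2) a3)) ,
    ≤B (ℕ.m≤n⊔m (a0 ⊔ a1 ⊔ a2 ⊔ a3) a4)
    where
    a0 = ∣ x0 ∣ ; a1 = ∣ x1 ∣ ; a2 = ∣ x2 ∣ ; a3 = ∣ x3 ∣ ; a4 = ∣ x4 ∣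
    ⊔ʳ : ∀ {m n o} → m ℕ.≤ n → m ℕ.≤ n ⊔ o
    ⊔ʳ {o = o} = ℕ.m≤n⇒m≤n⊔o o
    ≤B : ∀ {m} → m ℕ.≤ maxAbs x → toℚ (+ m) ≤ B
    ≤B m≤M = ℚ.≤-trans (toℚ-mono-≤ m≤M) M≤B

  H≡maxAbs/gcdAll : ∀ x k → gcdAll x ≡ suc k → H x ≡ + maxAbs x / suc k
  H≡maxAbs/gcdAll x k eq with gcdAll x
  H≡maxAbs/gcdAll x k refl | .(suc k) = refl

  gcdAll≢0 : ∀ x → lookup x (Fin.suc Fin.zero) ≢ ℤ.0ℤ → gcdAll x ≢ 0
  gcdAll≢0 (x0 ∷ x1 ∷ x2 ∷ x3 ∷ x4 ∷ []) x1≢0 g≡0 =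
    x1≢0 (ℤ.∣i∣≡0⇒i≡0 (gcd[m,n]≡0⇒m≡0 (gcd[m,n]≡0⇒n≡0 ∣ x0 ∣ g≡0)))

  H≤maxAbs : ∀ x → gcdAll x ≢ 0 → H x ≤ toℚ (+ maxAbs x)
  H≤maxAbs x g≢0 = bound (gcdAll x) refl
    where
    bound : ∀ g → gcdAll x ≡ g → H x ≤ toℚ (+ maxAbs x)
    bound zero    g≡0 = contradiction g≡0 g≢0
    bound (suc k) g≡k+1 = subst (_≤ toℚ (+ maxAbs x)) (sym (H≡maxAbs/gcdAll x k g≡k+1))
      (cross-≤⇒/≤/ (maxAbs x) (maxAbs x) k 0 (ℕ.*-monoʳ-≤ (maxAbs x) (ℕ.s≤s ℕ.z≤n)))

  maxAbs-scale : ∀ l y → maxAbs (map (l ℤ.*_) y) ≡ ∣ l ∣ ℕ.* maxAbs y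
  maxAbs-scale l (y0 ∷ y1 ∷ y2 ∷ y3 ∷ y4 ∷ []) = begin
    ∣ l ℤ.* y0 ∣ ⊔ ∣ l ℤ.* y1 ∣ ⊔ ∣ l ℤ.* y2 ∣ ⊔ ∣ l ℤ.* y3 ∣ ⊔ ∣ l ℤ.* y4 ∣
      ≡⟨ cong₂ _⊔_ (cong₂ _⊔_ (cong₂ _⊔_ (cong₂ _⊔_ (ℤ.abs-* l y0) (ℤ.abs-* l y1)) (ℤ.abs-* l y2))
                              (ℤ.abs-* l y3)) (ℤ.abs-* l y4) ⟩
    L ℕ.* a0 ⊔ L ℕ.* a1 ⊔ L ℕ.* a2 ⊔ L ℕ.* a3 ⊔ L ℕ.* a4
      ≡⟨ trans (ℕ.*-distribˡ-⊔ L (a0 ⊔ a1 ⊔ a2 ⊔ a3) a4) (cong (_⊔ L ℕ.* a4)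
           (trans (ℕ.*-distribˡ-⊔ L (a0 ⊔ a1 ⊔ a2) a3) (cong (_⊔ L ℕ.* a3)
             (trans (ℕ.*-distribˡ-⊔ L (a0 ⊔ a1) a2) (cong (_⊔ L ℕ.* a2) (ℕ.*-distribˡ-⊔ L a0 a1)))))) ⟨
    L ℕ.* (a0 ⊔ a1 ⊔ a2 ⊔ a3 ⊔ a4) ∎
    where
    open ≡-Reasoning
    L = ∣ l ∣ ; a0 = ∣ y0 ∣ ; a1 = ∣ y1 ∣ ; a2 = ∣ y2 ∣ ; a3 = ∣ y3 ∣ ; a4 = ∣ y4 ∣

  maxAbs≤H-scale : ∀ l y → l ≢ ℤ.0ℤ → ∣ l ∣ ≡ gcdAll (map (l ℤ.*_) y) → toℚ (+ maxAbs y) ≤ H (map (l ℤ.*_) y)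
  maxAbs≤H-scale l y l≢0 ∣l∣≡g = bound ∣ l ∣ refl
    where
    M = maxAbs y
    bound : ∀ L → ∣ l ∣ ≡ L → toℚ (+ M) ≤ H (map (l ℤ.*_) y)
    bound zero    ∣l∣≡0   = contradiction (ℤ.∣i∣≡0⇒i≡0 ∣l∣≡0) l≢0
    bound (suc k) ∣l∣≡k+1 =
      subst (toℚ (+ M) ≤_) (sym (H≡maxAbs/gcdAll (map (l ℤ.*_) y) k (trans (sym ∣l∣≡g) ∣l∣≡k+1)))
        (cross-≤⇒/≤/ M (maxAbs (map (l ℤ.*_) y)) 0 k (ℕ.≤-reflexive (begin
          M ℕ.* suc k                      ≡⟨ ℕ.*-comm M (suc k) ⟩
          suc k ℕ.* M                      ≡⟨ cong (ℕ._* M) ∣l∣≡k+1 ⟨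
          ∣ l ∣ ℕ.* M                      ≡⟨ maxAbs-scale l y ⟨
          maxAbs (map (l ℤ.*_) y)          ≡⟨ ℕ.*-identityʳ _ ⟨
          maxAbs (map (l ℤ.*_) y) ℕ.* 1    ∎)))
      where open ≡-Reasoning

module PrimitiveVectors where
  open Arithmetic
  open Height
  open import Data.Nat as ℕ using (ℕ; zero; suc; NonZero)
  import Data.Nat.Properties as ℕ
  open import Data.Nat.Divisibility using (_∣_; divides; ∣-trans; *-cancelʳ-∣; *-monoˡ-∣; ∣1⇒≡1)
  open import Data.Nat.GCD using (gcd; gcd[m,n]∣m; gcd[m,n]∣n; gcd-greatest)
  open import Data.Nat.Coprimality as C using (coprime-divisor)
  open import Data.Integer as ℤ using (ℤ; +_; -[1+_]; +[1+_]; ∣_∣; 0ℤ; 1ℤ; -1ℤ)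
  import Data.Integer.Properties as ℤ
  import Data.Integer.Divisibility.Signed as ℤ∣
  open import Data.Integer.Solver using (module +-*-Solver)
  open import Data.Vec using (Vec; _∷_; []; map; lookup)
  open import Data.Vec.Relation.Unary.All as All using (All; _∷_; [])
  open import Data.Vec.Relation.Unary.All.Properties using (map⁺; map⁻)
  open import Data.Vec.Properties using (map-∘; map-cong; lookup-map)
  import Data.Fin as Fin
  open import Data.Product using (Σ-syntax; _×_; _,_)
  open import Algebra.Properties.CommutativeSemigroup ℕ.*-commutativeSemigroup using (xy∙z≈xz∙y)
  open import Function.Base using (_∘_)
  open import Relation.Binary.PropositionalEquality
  open import Relation.Nullary.Negation using (contradiction)

  Primitive : ∀ {n} → Vec ℤ n → Set
  Primitive x = ∀ {d} → All (λ xᵢ → d ∣ ∣ xᵢ ∣) x → d ≡ 1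

  map-injective : ∀ {A B : Set} {f : A → B} → (∀ {a b} → f a ≡ f b → a ≡ b) →
    ∀ {n} {x y : Vec A n} → map f x ≡ map f y → x ≡ y
  map-injective f-inj {x = []}    {[]}    _  = refl
  map-injective f-inj {x = a ∷ x} {b ∷ y} eq =
    cong₂ _∷_ (f-inj (cong Data.Vec.head eq)) (map-injective f-inj (cong Data.Vec.tail eq))

  proportional-primitive⇒∣l∣≡∣m∣ : ∀ {n} {l m : ℤ} {x y : Vec ℤ n} → l ≢ 0ℤ →
    Primitive x → Primitive y → map (l ℤ.*_) x ≡ map (m ℤ.*_) y → ∣ l ∣ ≡ ∣ m ∣
  proportional-primitive⇒∣l∣≡∣m∣ {l = l} {m} {x} {y} l≢0 prim-x prim-y lx≡my
    with gcd-factorisation ∣ l ∣ ∣ m ∣ {{ℕ.≢-nonZero (l≢0 ∘ ℤ.∣i∣≡0⇒i≡0)}}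
  ... | l′ , m′ , g , g≢0 , ∣l∣≡l′g , ∣m∣≡m′g , l′⊥m′ = begin
    ∣ l ∣    ≡⟨ ∣l∣≡l′g ⟩
    l′ ℕ.* g ≡⟨ cong (ℕ._* g) (trans (prim-y (l′∣ lx≡my)) (sym (prim-x (m′∣ lx≡my)))) ⟩
    m′ ℕ.* g ≡⟨ ∣m∣≡m′g ⟨
    ∣ m ∣    ∎
    where
    open ≡-Reasoning
    reduced : ∀ {a b} → l ℤ.* a ≡ m ℤ.* b → l′ ℕ.* ∣ a ∣ ≡ m′ ℕ.* ∣ b ∣
    reduced {a} {b} la≡mb = ℕ.*-cancelʳ-≡ _ _ g {{g≢0}} (begin
      l′ ℕ.* ∣ a ∣ ℕ.* g ≡⟨ xy∙z≈xz∙y l′ ∣ a ∣ g ⟩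
      l′ ℕ.* g ℕ.* ∣ a ∣ ≡⟨ cong (ℕ._* ∣ a ∣) ∣l∣≡l′g ⟨
      ∣ l ∣ ℕ.* ∣ a ∣    ≡⟨ ℤ.abs-* l a ⟨
      ∣ l ℤ.* a ∣        ≡⟨ cong ∣_∣ la≡mb ⟩
      ∣ m ℤ.* b ∣        ≡⟨ ℤ.abs-* m b ⟩
      ∣ m ∣ ℕ.* ∣ b ∣    ≡⟨ cong (ℕ._* ∣ b ∣) ∣m∣≡m′g ⟩
      m′ ℕ.* g ℕ.* ∣ b ∣ ≡⟨ xy∙z≈xz∙y m′ ∣ b ∣ g ⟨
      m′ ℕ.* ∣ b ∣ ℕ.* g ∎)
    l′∣ : ∀ {k} {a b : Vec ℤ k} → map (l ℤ.*_) a ≡ map (m ℤ.*_) b → All (λ bᵢ → l′ ∣ ∣ bᵢ ∣) b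
    l′∣ {a = []} {[]} _ = []
    l′∣ {a = aᵢ ∷ a} {bᵢ ∷ b} eq =
      coprime-divisor l′⊥m′ (divides ∣ aᵢ ∣ (trans (sym (reduced (cong Data.Vec.head eq))) (ℕ.*-comm l′ ∣ aᵢ ∣)))
      ∷ l′∣ (cong Data.Vec.tail eq)
    m′∣ : ∀ {k} {a b : Vec ℤ k} → map (l ℤ.*_) a ≡ map (m ℤ.*_) b → All (λ aᵢ → m′ ∣ ∣ aᵢ ∣) a
    m′∣ {a = []} {[]} _ = []
    m′∣ {a = aᵢ ∷ a} {bᵢ ∷ b} eq =
      coprime-divisor (C.sym l′⊥m′) (divides ∣ bᵢ ∣ (trans (reduced (cong Data.Vec.head eq)) (ℕ.*-comm m′ ∣ bᵢ ∣)))
      ∷ m′∣ (cong Data.Vec.tail eq)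

  same-sign : ∀ l m {a b} → l ℤ.* + suc a ≡ m ℤ.* + suc b → ∣ l ∣ ≡ ∣ m ∣ → l ≡ m
  same-sign (+ _)    (+ _)    _  ∣l∣≡∣m∣ = cong +_ ∣l∣≡∣m∣
  same-sign -[1+ _ ] -[1+ _ ] _  ∣l∣≡∣m∣ = cong -[1+_] (ℕ.suc-injective ∣l∣≡∣m∣)
  same-sign (+ zero)  -[1+ _ ] _  ()
  same-sign (+ suc _) -[1+ _ ] ()
  same-sign -[1+ _ ] (+ zero)  _  ()
  same-sign -[1+ _ ] (+ suc _) ()

  ∼-primitive⇒≡ : ∀ {x y : Pt} → Primitive x → Primitive y →
    0ℤ ℤ.< lookup x (Fin.suc Fin.zero) → 0ℤ ℤ.< lookup y (Fin.suc Fin.zero) → x ∼ y → x ≡ y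
  ∼-primitive⇒≡ {x@(_ ∷ _ ∷ _)} {y@(_ ∷ _ ∷ _)} prim-x prim-y (ℤ.+<+ (ℕ.s≤s _)) (ℤ.+<+ (ℕ.s≤s _)) (l , m , l≢0 , _ , lx≡my) =
    map-injective (ℤ.*-cancelˡ-≡ l _ _ {{ℤ.≢-nonZero l≢0}})
      (trans lx≡my (cong (λ k → map (k ℤ.*_) y) (sym l≡m)))
    where
    l≡m : l ≡ m
    l≡m = same-sign l m (cong (Data.Vec.head ∘ Data.Vec.tail) lx≡my)
            (proportional-primitive⇒∣l∣≡∣m∣ {m = m} l≢0 prim-x prim-y lx≡my)

  gcdAll-∣ : ∀ x → All (λ xᵢ → gcdAll x ∣ ∣ xᵢ ∣) x
  gcdAll-∣ (x0 ∷ x1 ∷ x2 ∷ x3 ∷ x4 ∷ []) =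
    gcd[m,n]∣m a0 g1 ∷
    ∣-trans (gcd[m,n]∣n a0 g1) (gcd[m,n]∣m a1 g2) ∷
    ∣-trans (gcd[m,n]∣n a0 g1) (∣-trans (gcd[m,n]∣n a1 g2) (gcd[m,n]∣m a2 g3)) ∷
    ∣-trans (gcd[m,n]∣n a0 g1) (∣-trans (gcd[m,n]∣n a1 g2) (∣-trans (gcd[m,n]∣n a2 g3) (gcd[m,n]∣m a3 a4))) ∷
    ∣-trans (gcd[m,n]∣n a0 g1) (∣-trans (gcd[m,n]∣n a1 g2) (∣-trans (gcd[m,n]∣n a2 g3) (gcd[m,n]∣n a3 a4))) ∷ []
    where
    a0 = ∣ x0 ∣ ; a1 = ∣ x1 ∣ ; a2 = ∣ x2 ∣ ; a3 = ∣ x3 ∣ ; a4 = ∣ x4 ∣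
    g3 = gcd a3 a4 ; g2 = gcd a2 g3 ; g1 = gcd a1 g2

  ∣-gcdAll : ∀ {d} x → All (λ xᵢ → d ∣ ∣ xᵢ ∣) x → d ∣ gcdAll x
  ∣-gcdAll (_ ∷ _ ∷ _ ∷ _ ∷ _ ∷ []) (d0 ∷ d1 ∷ d2 ∷ d3 ∷ d4 ∷ []) =
    gcd-greatest d0 (gcd-greatest d1 (gcd-greatest d2 (gcd-greatest d3 d4)))

  divide-vector : ∀ {n} g (x : Vec ℤ n) → All (λ xᵢ → g ∣ ∣ xᵢ ∣) x → Σ[ q ∈ Vec ℤ n ] x ≡ map (+ g ℤ.*_) q
  divide-vector g []      []          = [] , refl
  divide-vector g (xᵢ ∷ x) (g∣xᵢ ∷ g∣x) with ℤ∣.∣ᵤ⇒∣ {+ g} g∣xᵢ | divide-vector g x g∣x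
  ... | ℤ∣.divides qᵢ xᵢ≡qᵢg | q , x≡gq = qᵢ ∷ q , cong₂ _∷_ (trans xᵢ≡qᵢg (ℤ.*-comm qᵢ (+ g))) x≡gq

  sign-normaliser : ∀ a → a ≢ 0ℤ → Σ[ σ ∈ ℤ ] σ ℤ.* σ ≡ 1ℤ × ∣ σ ∣ ≡ 1 × 0ℤ ℤ.< σ ℤ.* a
  sign-normaliser (+ zero)  a≢0 = contradiction refl a≢0
  sign-normaliser +[1+ n ] _ = 1ℤ , refl , refl , subst (0ℤ ℤ.<_) (sym (ℤ.*-identityˡ +[1+ n ])) (ℤ.+<+ (ℕ.s≤s ℕ.z≤n))
  sign-normaliser -[1+ n ] _ = -1ℤ , refl , refl , subst (0ℤ ℤ.<_) (sym (ℤ.-1*i≡-i -[1+ n ])) (ℤ.+<+ (ℕ.s≤s ℕ.z≤n))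

  opaque
    primitive-part : ∀ {n} g (x : Vec ℤ n) (i : Fin.Fin n) → {{NonZero g}} →
      All (λ xⱼ → g ∣ ∣ xⱼ ∣) x → (∀ {d} → All (λ xⱼ → d ∣ ∣ xⱼ ∣) x → d ∣ g) → lookup x i ≢ 0ℤ →
      Σ[ l ∈ ℤ ] Σ[ y ∈ Vec ℤ n ] l ≢ 0ℤ × x ≡ map (l ℤ.*_) y × ∣ l ∣ ≡ g × Primitive y × 0ℤ ℤ.< lookup y i
    primitive-part g x i g∣x greatest xᵢ≢0 with divide-vector g x g∣x
    ... | q , x≡gq with sign-normaliser (lookup q i) qᵢ≢0
      where
      qᵢ≢0 : lookup q i ≢ 0ℤ
      qᵢ≢0 qᵢ≡0 = xᵢ≢0 (begin
        lookup x i                 ≡⟨ cong (λ v → lookup v i) x≡gq ⟩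
        lookup (map (+ g ℤ.*_) q) i ≡⟨ lookup-map i (+ g ℤ.*_) q ⟩
        + g ℤ.* lookup q i          ≡⟨ cong (+ g ℤ.*_) qᵢ≡0 ⟩
        + g ℤ.* 0ℤ                  ≡⟨ ℤ.*-zeroʳ (+ g) ⟩
        0ℤ                          ∎)
        where open ≡-Reasoning
    ... | σ , σσ≡1 , ∣σ∣≡1 , 0<σqᵢ =
      σ ℤ.* + g , map (σ ℤ.*_) q , l≢0 , x≡l[σq] , ∣l∣≡g , prim-σq ,
      subst (0ℤ ℤ.<_) (sym (lookup-map i (σ ℤ.*_) q)) 0<σqᵢ
      where
      open +-*-Solver
      ∣σa∣≡∣a∣ : ∀ a → ∣ σ ℤ.* a ∣ ≡ ∣ a ∣
      ∣σa∣≡∣a∣ a = trans (ℤ.abs-* σ a) (trans (cong (ℕ._* ∣ a ∣) ∣σ∣≡1) (ℕ.*-identityˡ ∣ a ∣))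
      ∣l∣≡g : ∣ σ ℤ.* + g ∣ ≡ g
      ∣l∣≡g = ∣σa∣≡∣a∣ (+ g)
      l≢0 : σ ℤ.* + g ≢ 0ℤ
      l≢0 l≡0 = ℕ.≢-nonZero⁻¹ g (trans (sym ∣l∣≡g) (cong ∣_∣ l≡0))
      x≡l[σq] : x ≡ map ((σ ℤ.* + g) ℤ.*_) (map (σ ℤ.*_) q)
      x≡l[σq] = trans x≡gq (trans (map-cong rescale q) (map-∘ ((σ ℤ.* + g) ℤ.*_) (σ ℤ.*_) q))
        where
        rescale : ∀ a → + g ℤ.* a ≡ (σ ℤ.* + g) ℤ.* (σ ℤ.* a)
        rescale a = begin
          + g ℤ.* a                   ≡⟨ ℤ.*-identityˡ (+ g ℤ.* a) ⟨
          1ℤ ℤ.* (+ g ℤ.* a)          ≡⟨ cong (ℤ._* (+ g ℤ.* a)) σσ≡1 ⟨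
          σ ℤ.* σ ℤ.* (+ g ℤ.* a)     ≡⟨ solve 3 (λ s G a → s :* s :* (G :* a) := s :* G :* (s :* a)) refl σ (+ g) a ⟩
          σ ℤ.* + g ℤ.* (σ ℤ.* a)     ∎
          where open ≡-Reasoning
      prim-σq : Primitive (map (σ ℤ.*_) q)
      prim-σq {d} d∣σq = ∣1⇒≡1 (*-cancelʳ-∣ g (subst (d ℕ.* g ∣_) (sym (ℕ.*-identityˡ g)) (greatest dg∣x)))
        where
        dg∣gq : ∀ {a} → d ∣ ∣ σ ℤ.* a ∣ → d ℕ.* g ∣ ∣ + g ℤ.* a ∣
        dg∣gq {a} d∣σa = subst (d ℕ.* g ∣_) (trans (ℕ.*-comm ∣ a ∣ g) (sym (ℤ.abs-* (+ g) a)))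
                           (*-monoˡ-∣ g (subst (d ∣_) (∣σa∣≡∣a∣ a) d∣σa))
        dg∣x : All (λ xⱼ → d ℕ.* g ∣ ∣ xⱼ ∣) x
        dg∣x = subst (All (λ xⱼ → d ℕ.* g ∣ ∣ xⱼ ∣)) (sym x≡gq) (map⁺ (All.map dg∣gq (map⁻ d∣σq)))

module Parametrisation where
  open Arithmetic
  open PrimitiveVectors
  open import Data.Nat as ℕ using (ℕ; zero; suc; _*_; _^_; NonZero)
  import Data.Nat.Properties as ℕ
  open import Data.Nat.GCD using (gcd)
  open import Data.Nat.Divisibility using (_∣_; divides; ∣-refl; ∣-trans; ∣n⇒∣m*n)
  open import Data.Nat.Coprimality as C using (Coprime; coprime-divisor)
  open import Data.Integer as ℤ using (ℤ; +_; -[1+_]; ∣_∣; 0ℤ)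
  import Data.Integer.Properties as ℤ
  import Data.Integer.Tactic.RingSolver as ZS
  open import Algebra.Solver.CommutativeMonoid ℕ.*-1-commutativeMonoid using (solve; _⊜_)
  open import Data.Vec using (_∷_; [])
  open import Data.Vec.Relation.Unary.All using (_∷_; [])
  open import Data.Product using (_,_)
  open import Relation.Binary.PropositionalEquality

  pos-^ : ∀ m n → + (m ^ n) ≡ (+ m) ℤ.^ n
  pos-^ m zero    = refl
  pos-^ m (suc n) = trans (ℤ.pos-* m (m ^ n)) (cong (+ m ℤ.*_) (pos-^ m n))

  infixl 7 _⟨*⟩_ _⟨*_
  _⟨*⟩_ : ∀ {m n i j} → + m ≡ i → + n ≡ j → + (m * n) ≡ i ℤ.* j
  _⟨*⟩_ {m} {n} p q = trans (ℤ.pos-* m n) (cong₂ ℤ._*_ p q)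

  _⟨*_ : ∀ {m i} → + m ≡ i → ∀ n → + (m * n) ≡ i ℤ.* + n
  p ⟨* n = p ⟨*⟩ refl {x = + n}

  i*i≡+∣i∣*∣i∣ : ∀ i → i ℤ.* i ≡ + (∣ i ∣ * ∣ i ∣)
  i*i≡+∣i∣*∣i∣ (+ n)    = sym (ℤ.pos-* n n)
  i*i≡+∣i∣*∣i∣ -[1+ n ] = refl

  x+y+z≡0⇒x≡-[y+z] : ∀ x y z → x ℤ.+ y ℤ.+ z ≡ 0ℤ → x ≡ ℤ.- (y ℤ.+ z)
  x+y+z≡0⇒x≡-[y+z] x y z x+y+z≡0 = begin
    x                                  ≡⟨ split x y z ⟩
    (x ℤ.+ y ℤ.+ z) ℤ.+ ℤ.- (y ℤ.+ z)  ≡⟨ cong (ℤ._+ ℤ.- (y ℤ.+ z)) x+y+z≡0 ⟩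
    0ℤ ℤ.+ ℤ.- (y ℤ.+ z)               ≡⟨ ℤ.+-identityˡ _ ⟩
    ℤ.- (y ℤ.+ z)                      ∎
    where
    open ≡-Reasoning
    split : ∀ x y z → x ≡ (x ℤ.+ y ℤ.+ z) ℤ.+ ℤ.- (y ℤ.+ z)
    split = ZS.solve-∀


  x≡-[y+z]⇒x+y+z≡0 : ∀ x y z → x ≡ ℤ.- (y ℤ.+ z) → x ℤ.+ y ℤ.+ z ≡ 0ℤ
  x≡-[y+z]⇒x+y+z≡0 x y z x≡-[y+z] = begin
    x ℤ.+ y ℤ.+ z                ≡⟨ cong (λ x → x ℤ.+ y ℤ.+ z) x≡-[y+z] ⟩
    ℤ.- (y ℤ.+ z) ℤ.+ y ℤ.+ z    ≡⟨ cancel y z ⟩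
    0ℤ                           ∎
    where
    open ≡-Reasoning
    cancel : ∀ y z → ℤ.- (y ℤ.+ z) ℤ.+ y ℤ.+ z ≡ 0ℤ
    cancel = ZS.solve-∀

  param : (η₁ η₂ η₃ η₄ η₅ η₆ : ℕ) (α₁ α₂ α₃ : ℤ) → Param
  param η₁ η₂ η₃ η₄ η₅ η₆ α₁ α₂ α₃ = (+ η₁ ∷ + η₂ ∷ + η₃ ∷ + η₄ ∷ + η₅ ∷ + η₆ ∷ []) , (α₁ ∷ α₂ ∷ α₃ ∷ [])

  module Monomials (η₁ η₂ η₃ η₄ η₅ η₆ : ℕ) where

    N₀ N₁ N₂ N₃ : ℕ
    N₀ = η₁ ^ 2 * η₂ * η₃ ^ 2 * η₄ * η₅ ^ 2
    N₁ = η₁ ^ 4 * η₂ ^ 2 * η₃ ^ 3 * η₄ ^ 3 * η₅ ^ 2 * η₆ ^ 2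
    N₂ = η₁ ^ 3 * η₂ ^ 2 * η₃ ^ 2 * η₄ ^ 2 * η₅ * η₆
    N₃ = η₁ ^ 2 * η₂ * η₃ * η₄ ^ 2 * η₆ ^ 2

    Ψℕ : (α₁ α₂ α₃ : ℤ) → Pt
    Ψℕ α₁ α₂ α₃ = + N₀ ℤ.* α₂ ∷ + N₁ ∷ + N₂ ℤ.* α₁ ∷ + N₃ ℤ.* α₃ ∷ α₂ ℤ.* α₃ ∷ []

    Ψ-param : ∀ α₁ α₂ α₃ → Ψ (param η₁ η₂ η₃ η₄ η₅ η₆ α₁ α₂ α₃) ≡ Ψℕ α₁ α₂ α₃
    Ψ-param α₁ α₂ α₃ = sym (cong₂ _∷_ (cong (ℤ._* α₂) +N₀) (cong₂ _∷_ +N₁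
      (cong₂ _∷_ (cong (ℤ._* α₁) +N₂) (cong₂ _∷_ (cong (ℤ._* α₃) +N₃) refl))))
      where
      +N₀ = pos-^ η₁ 2 ⟨* η₂ ⟨*⟩ pos-^ η₃ 2 ⟨* η₄ ⟨*⟩ pos-^ η₅ 2
      +N₁ = pos-^ η₁ 4 ⟨*⟩ pos-^ η₂ 2 ⟨*⟩ pos-^ η₃ 3 ⟨*⟩ pos-^ η₄ 3 ⟨*⟩ pos-^ η₅ 2 ⟨*⟩ pos-^ η₆ 2
      +N₂ = pos-^ η₁ 3 ⟨*⟩ pos-^ η₂ 2 ⟨*⟩ pos-^ η₃ 2 ⟨*⟩ pos-^ η₄ 2 ⟨* η₅ ⟨* η₆
      +N₃ = pos-^ η₁ 2 ⟨* η₂ ⟨* η₃ ⟨*⟩ pos-^ η₄ 2 ⟨*⟩ pos-^ η₆ 2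

    U V M G : ℕ
    U = η₃ * η₅ * η₅
    V = η₄ * η₆ * η₆
    M = η₁ * η₁ * η₂
    G = M * η₃ * η₄

    N₀≡UG : N₀ ≡ U * G
    N₀≡UG = solve 6 (λ η₁ η₂ η₃ η₄ η₅ η₆ →
      η₁ ^ᵉ 2 · η₂ · η₃ ^ᵉ 2 · η₄ · η₅ ^ᵉ 2 ⊜ η₃ · η₅ · η₅ · (η₁ · η₁ · η₂ · η₃ · η₄)) refl η₁ η₂ η₃ η₄ η₅ η₆

    N₃≡VG : N₃ ≡ V * G
    N₃≡VG = solve 6 (λ η₁ η₂ η₃ η₄ η₅ η₆ →
      η₁ ^ᵉ 2 · η₂ · η₃ · η₄ ^ᵉ 2 · η₆ ^ᵉ 2 ⊜ η₄ · η₆ · η₆ · (η₁ · η₁ · η₂ · η₃ · η₄)) refl η₁ η₂ η₃ η₄ η₅ η₆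

    N₁≡N₀N₃ : N₁ ≡ N₀ * N₃
    N₁≡N₀N₃ = solve 6 (λ η₁ η₂ η₃ η₄ η₅ η₆ →
      η₁ ^ᵉ 4 · η₂ ^ᵉ 2 · η₃ ^ᵉ 3 · η₄ ^ᵉ 3 · η₅ ^ᵉ 2 · η₆ ^ᵉ 2
      ⊜ η₁ ^ᵉ 2 · η₂ · η₃ ^ᵉ 2 · η₄ · η₅ ^ᵉ 2 · (η₁ ^ᵉ 2 · η₂ · η₃ · η₄ ^ᵉ 2 · η₆ ^ᵉ 2)) refl η₁ η₂ η₃ η₄ η₅ η₆

    N₂²≡G³UVη₂ : N₂ * N₂ ≡ G * G * G * U * V * η₂
    N₂²≡G³UVη₂ = solve 6 (λ η₁ η₂ η₃ η₄ η₅ η₆ →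
      η₁ ^ᵉ 3 · η₂ ^ᵉ 2 · η₃ ^ᵉ 2 · η₄ ^ᵉ 2 · η₅ · η₆ · (η₁ ^ᵉ 3 · η₂ ^ᵉ 2 · η₃ ^ᵉ 2 · η₄ ^ᵉ 2 · η₅ · η₆)
      ⊜ G′ η₁ η₂ η₃ η₄ · G′ η₁ η₂ η₃ η₄ · G′ η₁ η₂ η₃ η₄ · (η₃ · η₅ · η₅) · (η₄ · η₆ · η₆) · η₂) refl η₁ η₂ η₃ η₄ η₅ η₆
      where G′ = λ η₁ η₂ η₃ η₄ → η₁ · η₁ · η₂ · η₃ · η₄

    private
      u g v : ℤ
      u = + U ; v = + V ; g = + G

      +N₀≡ug : + N₀ ≡ u ℤ.* g
      +N₀≡ug = trans (cong +_ N₀≡UG) (ℤ.pos-* U G)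

      +N₃≡vg : + N₃ ≡ v ℤ.* g
      +N₃≡vg = trans (cong +_ N₃≡VG) (ℤ.pos-* V G)

      +N₁≡+N₀+N₃ : + N₁ ≡ + N₀ ℤ.* + N₃
      +N₁≡+N₀+N₃ = trans (cong +_ N₁≡N₀N₃) (ℤ.pos-* N₀ N₃)

      +N₂²≡g³uvη₂ : + N₂ ℤ.* + N₂ ≡ g ℤ.* g ℤ.* g ℤ.* u ℤ.* v ℤ.* + η₂
      +N₂²≡g³uvη₂ = trans (sym (ℤ.pos-* N₂ N₂)) (trans (cong +_ N₂²≡G³UVη₂) (ℤ.pos-* G G ⟨* G ⟨* U ⟨* V ⟨* η₂))

    Ψℕ-quadric₁ : ∀ α₂ α₃ → + N₀ ℤ.* α₂ ℤ.* (+ N₃ ℤ.* α₃) ℤ.- + N₁ ℤ.* (α₂ ℤ.* α₃) ≡ 0ℤ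
    Ψℕ-quadric₁ α₂ α₃ = begin
      + N₀ ℤ.* α₂ ℤ.* (+ N₃ ℤ.* α₃) ℤ.- + N₁ ℤ.* (α₂ ℤ.* α₃)
        ≡⟨ cong (λ n₁ → + N₀ ℤ.* α₂ ℤ.* (+ N₃ ℤ.* α₃) ℤ.- n₁ ℤ.* (α₂ ℤ.* α₃)) +N₁≡+N₀+N₃ ⟩
      + N₀ ℤ.* α₂ ℤ.* (+ N₃ ℤ.* α₃) ℤ.- + N₀ ℤ.* + N₃ ℤ.* (α₂ ℤ.* α₃)
        ≡⟨ cancel (+ N₀) (+ N₃) α₂ α₃ ⟩
      0ℤ ∎
      where
      open ≡-Reasoning
      cancel : ∀ n₀ n₃ a₂ a₃ → n₀ ℤ.* a₂ ℤ.* (n₃ ℤ.* a₃) ℤ.- n₀ ℤ.* n₃ ℤ.* (a₂ ℤ.* a₃) ≡ 0ℤ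
      cancel = ZS.solve-∀

    Ψℕ-quadric₂ : ∀ α₁ α₂ α₃ →
      + η₂ ℤ.* α₁ ℤ.* α₁ ℤ.+ + η₃ ℤ.* + η₅ ℤ.* + η₅ ℤ.* α₂ ℤ.+ + η₄ ℤ.* + η₆ ℤ.* + η₆ ℤ.* α₃ ≡ 0ℤ →
      + N₀ ℤ.* α₂ ℤ.* + N₁ ℤ.+ + N₁ ℤ.* (+ N₃ ℤ.* α₃) ℤ.+ + N₂ ℤ.* α₁ ℤ.* (+ N₂ ℤ.* α₁) ≡ 0ℤ
    Ψℕ-quadric₂ α₁ α₂ α₃ torsor = begin
      + N₀ ℤ.* α₂ ℤ.* + N₁ ℤ.+ + N₁ ℤ.* (+ N₃ ℤ.* α₃) ℤ.+ n₂ ℤ.* α₁ ℤ.* (n₂ ℤ.* α₁)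
        ≡⟨ cong (λ n₁ → + N₀ ℤ.* α₂ ℤ.* n₁ ℤ.+ n₁ ℤ.* (+ N₃ ℤ.* α₃) ℤ.+ n₂ ℤ.* α₁ ℤ.* (n₂ ℤ.* α₁)) +N₁≡+N₀+N₃ ⟩
      + N₀ ℤ.* α₂ ℤ.* (+ N₀ ℤ.* + N₃) ℤ.+ + N₀ ℤ.* + N₃ ℤ.* (+ N₃ ℤ.* α₃) ℤ.+ n₂ ℤ.* α₁ ℤ.* (n₂ ℤ.* α₁)
        ≡⟨ cong₂ (λ n₀ n₃ → n₀ ℤ.* α₂ ℤ.* (n₀ ℤ.* n₃) ℤ.+ n₀ ℤ.* n₃ ℤ.* (n₃ ℤ.* α₃) ℤ.+ n₂ ℤ.* α₁ ℤ.* (n₂ ℤ.* α₁))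
                 +N₀≡ug +N₃≡vg ⟩
      u ℤ.* g ℤ.* α₂ ℤ.* (u ℤ.* g ℤ.* (v ℤ.* g)) ℤ.+ u ℤ.* g ℤ.* (v ℤ.* g) ℤ.* (v ℤ.* g ℤ.* α₃) ℤ.+ n₂ ℤ.* α₁ ℤ.* (n₂ ℤ.* α₁)
        ≡⟨ regroup u v g n₂ α₁ α₂ α₃ ⟩
      k ℤ.* (u ℤ.* α₂ ℤ.+ v ℤ.* α₃) ℤ.+ n₂ ℤ.* n₂ ℤ.* (α₁ ℤ.* α₁)
        ≡⟨ cong (λ m → k ℤ.* (u ℤ.* α₂ ℤ.+ v ℤ.* α₃) ℤ.+ m ℤ.* (α₁ ℤ.* α₁)) +N₂²≡g³uvη₂ ⟩
      k ℤ.* (u ℤ.* α₂ ℤ.+ v ℤ.* α₃) ℤ.+ k ℤ.* + η₂ ℤ.* (α₁ ℤ.* α₁)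
        ≡⟨ factor k u v (+ η₂) α₁ α₂ α₃ ⟩
      k ℤ.* (+ η₂ ℤ.* α₁ ℤ.* α₁ ℤ.+ u ℤ.* α₂ ℤ.+ v ℤ.* α₃)
        ≡⟨ cong (k ℤ.*_) torsor′ ⟩
      k ℤ.* 0ℤ
        ≡⟨ ℤ.*-zeroʳ k ⟩
      0ℤ ∎
      where
      open ≡-Reasoning
      n₂ k : ℤ
      n₂ = + N₂
      k = g ℤ.* g ℤ.* g ℤ.* u ℤ.* v
      torsor′ : + η₂ ℤ.* α₁ ℤ.* α₁ ℤ.+ u ℤ.* α₂ ℤ.+ v ℤ.* α₃ ≡ 0ℤ
      torsor′ = subst₂ (λ u v → + η₂ ℤ.* α₁ ℤ.* α₁ ℤ.+ u ℤ.* α₂ ℤ.+ v ℤ.* α₃ ≡ 0ℤ)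
                  (sym (ℤ.pos-* η₃ η₅ ⟨* η₅)) (sym (ℤ.pos-* η₄ η₆ ⟨* η₆)) torsor
      regroup : ∀ u v g n a₁ a₂ a₃ →
        u ℤ.* g ℤ.* a₂ ℤ.* (u ℤ.* g ℤ.* (v ℤ.* g)) ℤ.+ u ℤ.* g ℤ.* (v ℤ.* g) ℤ.* (v ℤ.* g ℤ.* a₃) ℤ.+ n ℤ.* a₁ ℤ.* (n ℤ.* a₁)
        ≡ g ℤ.* g ℤ.* g ℤ.* u ℤ.* v ℤ.* (u ℤ.* a₂ ℤ.+ v ℤ.* a₃) ℤ.+ n ℤ.* n ℤ.* (a₁ ℤ.* a₁)
      regroup = ZS.solve-∀
      factor : ∀ k u v e a₁ a₂ a₃ → k ℤ.* (u ℤ.* a₂ ℤ.+ v ℤ.* a₃) ℤ.+ k ℤ.* e ℤ.* (a₁ ℤ.* a₁)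
        ≡ k ℤ.* (e ℤ.* a₁ ℤ.* a₁ ℤ.+ u ℤ.* a₂ ℤ.+ v ℤ.* a₃)
      factor = ZS.solve-∀

    Ψℕ-on-S : ∀ α₁ α₂ α₃ →
      + η₂ ℤ.* α₁ ℤ.* α₁ ℤ.+ + η₃ ℤ.* + η₅ ℤ.* + η₅ ℤ.* α₂ ℤ.+ + η₄ ℤ.* + η₆ ℤ.* + η₆ ℤ.* α₃ ≡ 0ℤ →
      InS (Ψℕ α₁ α₂ α₃)
    Ψℕ-on-S α₁ α₂ α₃ torsor = Ψℕ-quadric₁ α₂ α₃ , Ψℕ-quadric₂ α₁ α₂ α₃ torsor

  record Admissible (η₁ η₂ η₃ η₄ η₅ η₆ : ℕ) (α₁ α₂ α₃ : ℤ) : Set where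
    field
      {{η₁≢0}} : NonZero η₁
      {{η₂≢0}} : NonZero η₂
      {{η₃≢0}} : NonZero η₃
      {{η₄≢0}} : NonZero η₄
      {{η₅≢0}} : NonZero η₅
      {{η₆≢0}} : NonZero η₆
      torsor : + η₂ ℤ.* α₁ ℤ.* α₁ ℤ.+ + η₃ ℤ.* + η₅ ℤ.* + η₅ ℤ.* α₂ ℤ.+ + η₄ ℤ.* + η₆ ℤ.* + η₆ ℤ.* α₃ ≡ 0ℤ
      η₁⊥η₅ : Coprime η₁ η₅
      η₁⊥η₆ : Coprime η₁ η₆
      η₂⊥η₃ : Coprime η₂ η₃
      η₂⊥η₄ : Coprime η₂ η₄
      η₂⊥η₅ : Coprime η₂ η₅
      η₂⊥η₆ : Coprime η₂ η₆
      η₃⊥η₄ : Coprime η₃ η₄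
      η₃⊥η₆ : Coprime η₃ η₆
      η₄⊥η₅ : Coprime η₄ η₅
      η₅⊥η₆ : Coprime η₅ η₆
      α₁⊥η : Coprime ∣ α₁ ∣ (η₁ * η₃ * η₄ * η₅ * η₆)
      α₂⊥η : Coprime ∣ α₂ ∣ (η₁ * η₂ * η₃ * η₄ * η₆)
      α₃⊥η : Coprime ∣ α₃ ∣ (η₁ * η₂ * η₃ * η₄ * η₅)

  data AdmissibleParam : Param → Set where
    admissible : ∀ {η₁ η₂ η₃ η₄ η₅ η₆ α₁ α₂ α₃} → Admissible η₁ η₂ η₃ η₄ η₅ η₆ α₁ α₂ α₃ →
      AdmissibleParam (param η₁ η₂ η₃ η₄ η₅ η₆ α₁ α₂ α₃)

  private
    Cop⇒Coprime : ∀ {m n} → Cop (+ m) (+ n) → Coprime m n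
    Cop⇒Coprime gcd≡1 = C.gcd≡1⇒coprime (ℤ.+-injective gcd≡1)

    Coprime⇒Cop : ∀ {m n} → Coprime m n → Cop (+ m) (+ n)
    Coprime⇒Cop m⊥n = cong +_ (C.coprime⇒gcd≡1 m⊥n)

    +-product : ∀ a b c d e → + (a * b * c * d * e) ≡ + a ℤ.* + b ℤ.* + c ℤ.* + d ℤ.* + e
    +-product a b c d e = ℤ.pos-* a b ⟨* c ⟨* d ⟨* e

    Cop-product⇒Coprime : ∀ α a b c d e → Cop α (+ a ℤ.* + b ℤ.* + c ℤ.* + d ℤ.* + e) → Coprime ∣ α ∣ (a * b * c * d * e)
    Cop-product⇒Coprime α a b c d e gcd≡1 =
      C.gcd≡1⇒coprime (ℤ.+-injective (subst (Cop α) (sym (+-product a b c d e)) gcd≡1))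

    Coprime⇒Cop-product : ∀ α a b c d e → Coprime ∣ α ∣ (a * b * c * d * e) → Cop α (+ a ℤ.* + b ℤ.* + c ℤ.* + d ℤ.* + e)
    Coprime⇒Cop-product α a b c d e α⊥ = subst (Cop α) (+-product a b c d e) (cong +_ (C.coprime⇒gcd≡1 α⊥))

  InT1⇒AdmissibleParam : ∀ {B} t → InT1 B t → AdmissibleParam t
  InT1⇒AdmissibleParam ((+ η₁ ∷ + η₂ ∷ + η₃ ∷ + η₄ ∷ + η₅ ∷ + η₆ ∷ []) , (α₁ ∷ α₂ ∷ α₃ ∷ []))
    (ℤ.+<+ 0<η₁ , ℤ.+<+ 0<η₂ , ℤ.+<+ 0<η₃ , ℤ.+<+ 0<η₄ , ℤ.+<+ 0<η₅ , ℤ.+<+ 0<η₆ , torsor ,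
     c₁₅ , c₁₆ , c₂₃ , c₂₄ , c₂₅ , c₂₆ , c₃₄ , c₃₆ , c₄₅ , c₅₆ , cα₁ , cα₂ , cα₃ , _) = admissible (record
    { η₁≢0 = ℕ.>-nonZero 0<η₁ ; η₂≢0 = ℕ.>-nonZero 0<η₂ ; η₃≢0 = ℕ.>-nonZero 0<η₃
    ; η₄≢0 = ℕ.>-nonZero 0<η₄ ; η₅≢0 = ℕ.>-nonZero 0<η₅ ; η₆≢0 = ℕ.>-nonZero 0<η₆
    ; torsor = torsor
    ; η₁⊥η₅ = Cop⇒Coprime c₁₅ ; η₁⊥η₆ = Cop⇒Coprime c₁₆ ; η₂⊥η₃ = Cop⇒Coprime c₂₃
    ; η₂⊥η₄ = Cop⇒Coprime c₂₄ ; η₂⊥η₅ = Cop⇒Coprime c₂₅ ; η₂⊥η₆ = Cop⇒Coprime c₂₆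
    ; η₃⊥η₄ = Cop⇒Coprime c₃₄ ; η₃⊥η₆ = Cop⇒Coprime c₃₆ ; η₄⊥η₅ = Cop⇒Coprime c₄₅
    ; η₅⊥η₆ = Cop⇒Coprime c₅₆
    ; α₁⊥η = Cop-product⇒Coprime α₁ η₁ η₃ η₄ η₅ η₆ cα₁
    ; α₂⊥η = Cop-product⇒Coprime α₂ η₁ η₂ η₃ η₄ η₆ cα₂
    ; α₃⊥η = Cop-product⇒Coprime α₃ η₁ η₂ η₃ η₄ η₅ cα₃
    })

  InT1-bound : ∀ {B} t → InT1 B t → AllAbsLe (Ψ t) B
  InT1-bound ((_ ∷ _ ∷ _ ∷ _ ∷ _ ∷ _ ∷ []) , (_ ∷ _ ∷ _ ∷ []))
    (_ , _ , _ , _ , _ , _ , _ , _ , _ , _ , _ , _ , _ , _ , _ , _ , _ , _ , _ , _ , bound) = bound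

  Admissible⇒InT1 : ∀ {B η₁ η₂ η₃ η₄ η₅ η₆ α₁ α₂ α₃} → Admissible η₁ η₂ η₃ η₄ η₅ η₆ α₁ α₂ α₃ →
    AllAbsLe (Ψ (param η₁ η₂ η₃ η₄ η₅ η₆ α₁ α₂ α₃)) B → InT1 B (param η₁ η₂ η₃ η₄ η₅ η₆ α₁ α₂ α₃)
  Admissible⇒InT1 {η₁ = η₁} {η₂} {η₃} {η₄} {η₅} {η₆} {α₁} {α₂} {α₃} A bound =
    pos η₁ , pos η₂ , pos η₃ , pos η₄ , pos η₅ , pos η₆ , torsor ,
    Coprime⇒Cop η₁⊥η₅ , Coprime⇒Cop η₁⊥η₆ , Coprime⇒Cop η₂⊥η₃ , Coprime⇒Cop η₂⊥η₄ , Coprime⇒Cop η₂⊥η₅ ,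
    Coprime⇒Cop η₂⊥η₆ , Coprime⇒Cop η₃⊥η₄ , Coprime⇒Cop η₃⊥η₆ , Coprime⇒Cop η₄⊥η₅ , Coprime⇒Cop η₅⊥η₆ ,
    Coprime⇒Cop-product α₁ η₁ η₃ η₄ η₅ η₆ α₁⊥η , Coprime⇒Cop-product α₂ η₁ η₂ η₃ η₄ η₆ α₂⊥η ,
    Coprime⇒Cop-product α₃ η₁ η₂ η₃ η₄ η₅ α₃⊥η , bound
    where
    open Admissible A
    pos : ∀ n → {{NonZero n}} → 0ℤ ℤ.< + n
    pos n = ℤ.+<+ (ℕ.>-nonZero⁻¹ n)

  module AdmissibleProperties {η₁ η₂ η₃ η₄ η₅ η₆ α₁ α₂ α₃} (A : Admissible η₁ η₂ η₃ η₄ η₅ η₆ α₁ α₂ α₃) where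
    open Monomials η₁ η₂ η₃ η₄ η₅ η₆
    open Admissible A

    private
      P₅ P₆ : ℕ
      P₅ = η₁ * η₂ * η₃ * η₄ * η₅
      P₆ = η₁ * η₂ * η₃ * η₄ * η₆

      N₀∣P₅² : N₀ ∣ P₅ ^ 2
      N₀∣P₅² = divides (η₂ * η₄) (solve 6 (λ η₁ η₂ η₃ η₄ η₅ η₆ →
        (η₁ · η₂ · η₃ · η₄ · η₅) ^ᵉ 2 ⊜ η₂ · η₄ · (η₁ ^ᵉ 2 · η₂ · η₃ ^ᵉ 2 · η₄ · η₅ ^ᵉ 2)) refl η₁ η₂ η₃ η₄ η₅ η₆)

      N₃∣P₆² : N₃ ∣ P₆ ^ 2
      N₃∣P₆² = divides (η₂ * η₃) (solve 6 (λ η₁ η₂ η₃ η₄ η₅ η₆ →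
        (η₁ · η₂ · η₃ · η₄ · η₆) ^ᵉ 2 ⊜ η₂ · η₃ · (η₁ ^ᵉ 2 · η₂ · η₃ · η₄ ^ᵉ 2 · η₆ ^ᵉ 2)) refl η₁ η₂ η₃ η₄ η₅ η₆)

      Q : ℕ
      Q = η₁ ^ 4 * η₂ ^ 2 * η₃ ^ 3 * η₄ ^ 3 * η₅ ^ 2

      Q∣P₅⁴ : Q ∣ P₅ ^ 4
      Q∣P₅⁴ = divides (η₂ ^ 2 * η₃ * η₄ * η₅ ^ 2) (solve 6 (λ η₁ η₂ η₃ η₄ η₅ η₆ →
        (η₁ · η₂ · η₃ · η₄ · η₅) ^ᵉ 4 ⊜ η₂ ^ᵉ 2 · η₃ · η₄ · η₅ ^ᵉ 2 · (η₁ ^ᵉ 4 · η₂ ^ᵉ 2 · η₃ ^ᵉ 3 · η₄ ^ᵉ 3 · η₅ ^ᵉ 2))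
        refl η₁ η₂ η₃ η₄ η₅ η₆)

    Ψℕ-primitive : Primitive (Ψℕ α₁ α₂ α₃)
    Ψℕ-primitive {d} (d∣x₀ ∷ d∣N₁ ∷ _ ∷ d∣x₃ ∷ d∣α₂α₃ ∷ []) =
      coprime-∣⇒≡1 (coprime-*ʳ (coprime-∣ʳ-^ 2 d⊥P₆ N₃∣P₆²) d⊥α₃) (subst (d ∣_) (ℤ.abs-* (+ N₃) α₃) d∣x₃)
      where
      d∣N₀α₂ : d ∣ N₀ * ∣ α₂ ∣
      d∣N₀α₂ = subst (d ∣_) (ℤ.abs-* (+ N₀) α₂) d∣x₀
      d⊥α₃ : Coprime d ∣ α₃ ∣
      d⊥α₃ {c} (c∣d , c∣α₃) = coprime-∣⇒≡1 (coprime-*ʳ c⊥η₆ c⊥η₆) c∣η₆η₆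
        where
        c⊥P₅ : Coprime c P₅
        c⊥P₅ = coprime-∣ˡ α₃⊥η c∣α₃
        c∣α₂ : c ∣ ∣ α₂ ∣
        c∣α₂ = coprime-divisor (coprime-∣ʳ-^ 2 c⊥P₅ N₀∣P₅²) (∣-trans c∣d d∣N₀α₂)
        c⊥η₆ : Coprime c η₆
        c⊥η₆ = coprime-∣ʳ (coprime-∣ˡ α₂⊥η c∣α₂) (∣n⇒∣m*n (η₁ * η₂ * η₃ * η₄) ∣-refl)
        c∣η₆η₆ : c ∣ η₆ * η₆
        c∣η₆η₆ = coprime-divisor (coprime-∣ʳ-^ 4 c⊥P₅ Q∣P₅⁴) (subst (c ∣_) N₁≡Qη₆² (∣-trans c∣d d∣N₁))
          where
          N₁≡Qη₆² : N₁ ≡ Q * (η₆ * η₆)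
          N₁≡Qη₆² = solve 6 (λ η₁ η₂ η₃ η₄ η₅ η₆ →
            η₁ ^ᵉ 4 · η₂ ^ᵉ 2 · η₃ ^ᵉ 3 · η₄ ^ᵉ 3 · η₅ ^ᵉ 2 · η₆ ^ᵉ 2
            ⊜ η₁ ^ᵉ 4 · η₂ ^ᵉ 2 · η₃ ^ᵉ 3 · η₄ ^ᵉ 3 · η₅ ^ᵉ 2 · (η₆ · η₆)) refl η₁ η₂ η₃ η₄ η₅ η₆
      d⊥P₆ : Coprime d P₆
      d⊥P₆ = coprime-∣ˡ α₂⊥η (coprime-divisor d⊥α₃ (subst (d ∣_) (trans (ℤ.abs-* α₂ α₃) (ℕ.*-comm ∣ α₂ ∣ ∣ α₃ ∣)) d∣α₂α₃))

    N₀≢0 : NonZero N₀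
    N₀≢0 = ℕ.m^n≢0 η₁ 2 *≢0 η₂≢0 *≢0 ℕ.m^n≢0 η₃ 2 *≢0 η₄≢0 *≢0 ℕ.m^n≢0 η₅ 2

    N₁≢0 : NonZero N₁
    N₁≢0 = ℕ.m^n≢0 η₁ 4 *≢0 ℕ.m^n≢0 η₂ 2 *≢0 ℕ.m^n≢0 η₃ 3 *≢0 ℕ.m^n≢0 η₄ 3 *≢0 ℕ.m^n≢0 η₅ 2 *≢0 ℕ.m^n≢0 η₆ 2

    N₂≢0 : NonZero N₂
    N₂≢0 = ℕ.m^n≢0 η₁ 3 *≢0 ℕ.m^n≢0 η₂ 2 *≢0 ℕ.m^n≢0 η₃ 2 *≢0 ℕ.m^n≢0 η₄ 2 *≢0 η₅≢0 *≢0 η₆≢0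

    N₃≢0 : NonZero N₃
    N₃≢0 = ℕ.m^n≢0 η₁ 2 *≢0 η₂≢0 *≢0 η₃≢0 *≢0 ℕ.m^n≢0 η₄ 2 *≢0 ℕ.m^n≢0 η₆ 2

    G≢0 : NonZero G
    G≢0 = η₁≢0 *≢0 η₁≢0 *≢0 η₂≢0 *≢0 η₃≢0 *≢0 η₄≢0

    private
      U⊥V : Coprime U V
      U⊥V = coprime-*ˡ (coprime-*ˡ η₃⊥V η₅⊥V) η₅⊥V
        where
        η₃⊥V = coprime-*ʳ (coprime-*ʳ η₃⊥η₄ η₃⊥η₆) η₃⊥η₆
        η₅⊥V = coprime-*ʳ (coprime-*ʳ (C.sym η₄⊥η₅) η₅⊥η₆) η₅⊥η₆

    gcd[N₀α₂,N₁]≡N₀ : gcd (N₀ * ∣ α₂ ∣) N₁ ≡ N₀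
    gcd[N₀α₂,N₁]≡N₀ = begin
      gcd (N₀ * ∣ α₂ ∣) N₁        ≡⟨ cong₂ gcd (ℕ.*-comm N₀ ∣ α₂ ∣) (trans N₁≡N₀N₃ (ℕ.*-comm N₀ N₃)) ⟩
      gcd (∣ α₂ ∣ * N₀) (N₃ * N₀) ≡⟨ gcd[m*o,n*o]≡o N₀ (coprime-∣ʳ-^ 2 α₂⊥η N₃∣P₆²) ⟩
      N₀                          ∎
      where open ≡-Reasoning

    gcd[N₀,N₃]≡G : gcd N₀ N₃ ≡ G
    gcd[N₀,N₃]≡G = trans (cong₂ gcd N₀≡UG N₃≡VG) (gcd[m*o,n*o]≡o G U⊥V)

    gcd[U,G]≡η₃ : gcd U G ≡ η₃
    gcd[U,G]≡η₃ = begin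
      gcd U G                                   ≡⟨ cong₂ gcd U≡η₅²η₃ G≡Mη₄η₃ ⟩
      gcd (η₅ * η₅ * η₃) (M * η₄ * η₃)          ≡⟨ gcd[m*o,n*o]≡o η₃ (coprime-*ˡ η₅⊥Mη₄ η₅⊥Mη₄) ⟩
      η₃                                        ∎
      where
      open ≡-Reasoning
      U≡η₅²η₃ : U ≡ η₅ * η₅ * η₃
      U≡η₅²η₃ = solve 6 (λ η₁ η₂ η₃ η₄ η₅ η₆ → η₃ · η₅ · η₅ ⊜ η₅ · η₅ · η₃) refl η₁ η₂ η₃ η₄ η₅ η₆
      G≡Mη₄η₃ : G ≡ M * η₄ * η₃
      G≡Mη₄η₃ = solve 6 (λ η₁ η₂ η₃ η₄ η₅ η₆ → η₁ · η₁ · η₂ · η₃ · η₄ ⊜ η₁ · η₁ · η₂ · η₄ · η₃) refl η₁ η₂ η₃ η₄ η₅ η₆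
      η₅⊥Mη₄ : Coprime η₅ (M * η₄)
      η₅⊥Mη₄ = coprime-*ʳ (coprime-*ʳ (coprime-*ʳ (C.sym η₁⊥η₅) (C.sym η₁⊥η₅)) (C.sym η₂⊥η₅)) (C.sym η₄⊥η₅)

    gcd[V,G]≡η₄ : gcd V G ≡ η₄
    gcd[V,G]≡η₄ = begin
      gcd V G                         ≡⟨ cong (λ v → gcd v G) V≡η₆²η₄ ⟩
      gcd (η₆ * η₆ * η₄) (M * η₃ * η₄) ≡⟨ gcd[m*o,n*o]≡o η₄ (coprime-*ˡ η₆⊥Mη₃ η₆⊥Mη₃) ⟩
      η₄                              ∎
      where
      open ≡-Reasoning
      V≡η₆²η₄ : V ≡ η₆ * η₆ * η₄
      V≡η₆²η₄ = solve 6 (λ η₁ η₂ η₃ η₄ η₅ η₆ → η₄ · η₆ · η₆ ⊜ η₆ · η₆ · η₄) refl η₁ η₂ η₃ η₄ η₅ η₆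
      η₆⊥Mη₃ : Coprime η₆ (M * η₃)
      η₆⊥Mη₃ = coprime-*ʳ (coprime-*ʳ (coprime-*ʳ (C.sym η₁⊥η₆) (C.sym η₁⊥η₆)) (C.sym η₂⊥η₆)) (C.sym η₃⊥η₆)

    gcd[M,η₂α₁²]≡η₂ : gcd M (η₂ * ∣ α₁ ∣ * ∣ α₁ ∣) ≡ η₂
    gcd[M,η₂α₁²]≡η₂ = trans (cong (gcd M) (η₂aa≡aaη₂ η₂ ∣ α₁ ∣))
      (gcd[m*o,n*o]≡o η₂ (C.sym (coprime-square α₁⊥η₁)))
      where
      η₂aa≡aaη₂ : ∀ e a → e * a * a ≡ a * a * e
      η₂aa≡aaη₂ e a = solve 2 (λ e a → e · a · a ⊜ a · a · e) refl e a
      α₁⊥η₁ : Coprime ∣ α₁ ∣ η₁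
      α₁⊥η₁ = coprime-∣ʳ α₁⊥η (divides (η₃ * η₄ * η₅ * η₆)
        (solve 5 (λ η₁ η₃ η₄ η₅ η₆ → η₁ · η₃ · η₄ · η₅ · η₆ ⊜ η₃ · η₄ · η₅ · η₆ · η₁) refl η₁ η₃ η₄ η₅ η₆))

    η₂α₁²≡∣Uα₂+Vα₃∣ : η₂ * ∣ α₁ ∣ * ∣ α₁ ∣ ≡ ∣ + U ℤ.* α₂ ℤ.+ + V ℤ.* α₃ ∣
    η₂α₁²≡∣Uα₂+Vα₃∣ = begin
      η₂ * ∣ α₁ ∣ * ∣ α₁ ∣       ≡⟨ cong (_* ∣ α₁ ∣) (ℤ.abs-* (+ η₂) α₁) ⟨
      ∣ + η₂ ℤ.* α₁ ∣ * ∣ α₁ ∣    ≡⟨ ℤ.abs-* (+ η₂ ℤ.* α₁) α₁ ⟨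
      ∣ + η₂ ℤ.* α₁ ℤ.* α₁ ∣      ≡⟨ cong ∣_∣ (x+y+z≡0⇒x≡-[y+z] (+ η₂ ℤ.* α₁ ℤ.* α₁) y z torsor) ⟩
      ∣ ℤ.- (y ℤ.+ z) ∣           ≡⟨ ℤ.∣-i∣≡∣i∣ (y ℤ.+ z) ⟩
      ∣ y ℤ.+ z ∣                 ≡⟨ cong₂ (λ u v → ∣ u ℤ.* α₂ ℤ.+ v ℤ.* α₃ ∣) (ℤ.pos-* η₃ η₅ ⟨* η₅) (ℤ.pos-* η₄ η₆ ⟨* η₆) ⟨
      ∣ + U ℤ.* α₂ ℤ.+ + V ℤ.* α₃ ∣ ∎
      where
      open ≡-Reasoning
      y = + η₃ ℤ.* + η₅ ℤ.* + η₅ ℤ.* α₂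
      z = + η₄ ℤ.* + η₆ ℤ.* + η₆ ℤ.* α₃

    0<N₁ : 0ℤ ℤ.< + N₁
    0<N₁ = ℤ.+<+ (ℕ.>-nonZero⁻¹ N₁ {{N₁≢0}})

module Injectivity where
  open Arithmetic
  open Parametrisation
  open import Data.Nat as ℕ using (ℕ; _*_)
  import Data.Nat.Properties as ℕ
  open import Data.Nat.GCD using (gcd)
  open import Data.Integer as ℤ using (ℤ; +_; ∣_∣)
  import Data.Integer.Properties as ℤ
  open import Data.Vec using (lookup; _∷_)
  open import Data.Product using (_,_)
  open import Data.Fin using (zero; suc)
  open import Relation.Binary.PropositionalEquality

  module _ {η₁ η₂ η₃ η₄ η₅ η₆ α₁ α₂ α₃ η₁′ η₂′ η₃′ η₄′ η₅′ η₆′ α₁′ α₂′ α₃′}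
    (A : Admissible η₁ η₂ η₃ η₄ η₅ η₆ α₁ α₂ α₃) (A′ : Admissible η₁′ η₂′ η₃′ η₄′ η₅′ η₆′ α₁′ α₂′ α₃′)
    (Ψ≡Ψ′ : Monomials.Ψℕ η₁ η₂ η₃ η₄ η₅ η₆ α₁ α₂ α₃ ≡ Monomials.Ψℕ η₁′ η₂′ η₃′ η₄′ η₅′ η₆′ α₁′ α₂′ α₃′) where

    private
      module X = Monomials η₁ η₂ η₃ η₄ η₅ η₆
      module X′ = Monomials η₁′ η₂′ η₃′ η₄′ η₅′ η₆′
      module A = AdmissibleProperties A
      module A′ = AdmissibleProperties A′
      open ≡-Reasoning

      component : ∀ i → lookup (X.Ψℕ α₁ α₂ α₃) i ≡ lookup (X′.Ψℕ α₁′ α₂′ α₃′) i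
      component i = cong (λ x → lookup x i) Ψ≡Ψ′
      N₁≡ : X.N₁ ≡ X′.N₁
      N₁≡ = ℤ.+-injective (component (suc zero))
      N₀≡ : X.N₀ ≡ X′.N₀
      N₀≡ = begin
        X.N₀                               ≡⟨ A.gcd[N₀α₂,N₁]≡N₀ ⟨
        gcd (X.N₀ * ∣ α₂ ∣) X.N₁           ≡⟨ cong₂ gcd ∣x₀∣≡ N₁≡ ⟩
        gcd (X′.N₀ * ∣ α₂′ ∣) X′.N₁        ≡⟨ A′.gcd[N₀α₂,N₁]≡N₀ ⟩
        X′.N₀                              ∎
        where
        ∣x₀∣≡ = trans (sym (ℤ.abs-* (+ X.N₀) α₂)) (trans (cong ∣_∣ (component zero)) (ℤ.abs-* (+ X′.N₀) α₂′))
      α₂≡ : α₂ ≡ α₂′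
      α₂≡ = ℤ.*-cancelˡ-≡ (+ X.N₀) α₂ α₂′ {{A.N₀≢0}} (trans (component zero) (cong (λ n → + n ℤ.* α₂′) (sym N₀≡)))
      N₃≡ : X.N₃ ≡ X′.N₃
      N₃≡ = ℕ.*-cancelˡ-≡ X.N₃ X′.N₃ X.N₀ {{A.N₀≢0}}
        (trans (sym X.N₁≡N₀N₃) (trans N₁≡ (trans X′.N₁≡N₀N₃ (cong (_* X′.N₃) (sym N₀≡)))))
      α₃≡ : α₃ ≡ α₃′
      α₃≡ = ℤ.*-cancelˡ-≡ (+ X.N₃) α₃ α₃′ {{A.N₃≢0}}
        (trans (component (suc (suc (suc zero)))) (cong (λ n → + n ℤ.* α₃′) (sym N₃≡)))
      G≡ : X.G ≡ X′.G
      G≡ = trans (sym A.gcd[N₀,N₃]≡G) (trans (cong₂ gcd N₀≡ N₃≡) A′.gcd[N₀,N₃]≡G)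
      U≡ : X.U ≡ X′.U
      U≡ = ℕ.*-cancelʳ-≡ X.U X′.U X.G {{A.G≢0}}
        (trans (sym X.N₀≡UG) (trans N₀≡ (trans X′.N₀≡UG (cong (X′.U *_) (sym G≡)))))
      V≡ : X.V ≡ X′.V
      V≡ = ℕ.*-cancelʳ-≡ X.V X′.V X.G {{A.G≢0}}
        (trans (sym X.N₃≡VG) (trans N₃≡ (trans X′.N₃≡VG (cong (X′.V *_) (sym G≡)))))
      η₃≡ : η₃ ≡ η₃′
      η₃≡ = trans (sym A.gcd[U,G]≡η₃) (trans (cong₂ gcd U≡ G≡) A′.gcd[U,G]≡η₃)
      η₄≡ : η₄ ≡ η₄′
      η₄≡ = trans (sym A.gcd[V,G]≡η₄) (trans (cong₂ gcd V≡ G≡) A′.gcd[V,G]≡η₄)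
      η₅≡ : η₅ ≡ η₅′
      η₅≡ = m*m≡n*n⇒m≡n (ℕ.*-cancelˡ-≡ (η₅ * η₅) (η₅′ * η₅′) η₃ {{Admissible.η₃≢0 A}}
        (trans (sym (ℕ.*-assoc η₃ η₅ η₅)) (trans U≡ (trans (ℕ.*-assoc η₃′ η₅′ η₅′) (cong (λ e → e * (η₅′ * η₅′)) (sym η₃≡))))))
      η₆≡ : η₆ ≡ η₆′
      η₆≡ = m*m≡n*n⇒m≡n (ℕ.*-cancelˡ-≡ (η₆ * η₆) (η₆′ * η₆′) η₄ {{Admissible.η₄≢0 A}}
        (trans (sym (ℕ.*-assoc η₄ η₆ η₆)) (trans V≡ (trans (ℕ.*-assoc η₄′ η₆′ η₆′) (cong (λ e → e * (η₆′ * η₆′)) (sym η₄≡))))))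
      M≡ : X.M ≡ X′.M
      M≡ = ℕ.*-cancelʳ-≡ X.M X′.M η₃ {{Admissible.η₃≢0 A}} (ℕ.*-cancelʳ-≡ (X.M * η₃) (X′.M * η₃) η₄ {{Admissible.η₄≢0 A}}
        (trans G≡ (cong₂ (λ e₃ e₄ → X′.M * e₃ * e₄) (sym η₃≡) (sym η₄≡))))
      η₂α₁²≡ : η₂ * ∣ α₁ ∣ * ∣ α₁ ∣ ≡ η₂′ * ∣ α₁′ ∣ * ∣ α₁′ ∣
      η₂α₁²≡ = trans A.η₂α₁²≡∣Uα₂+Vα₃∣ (trans (cong₂ (λ u v → ∣ u ℤ.+ v ∣)
        (cong₂ (λ n a → + n ℤ.* a) U≡ α₂≡) (cong₂ (λ n a → + n ℤ.* a) V≡ α₃≡)) (sym A′.η₂α₁²≡∣Uα₂+Vα₃∣))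
      η₂≡ : η₂ ≡ η₂′
      η₂≡ = trans (sym A.gcd[M,η₂α₁²]≡η₂) (trans (cong₂ gcd M≡ η₂α₁²≡) A′.gcd[M,η₂α₁²]≡η₂)
      η₁≡ : η₁ ≡ η₁′
      η₁≡ = m*m≡n*n⇒m≡n (ℕ.*-cancelʳ-≡ (η₁ * η₁) (η₁′ * η₁′) η₂ {{Admissible.η₂≢0 A}} (trans M≡ (cong (η₁′ * η₁′ *_) (sym η₂≡))))
      N₂≡ : X.N₂ ≡ X′.N₂
      N₂≡ = N₂-cong η₁≡ η₂≡ η₃≡ η₄≡ η₅≡ η₆≡
        where
        N₂-cong : ∀ {a b c d e f a′ b′ c′ d′ e′ f′} → a ≡ a′ → b ≡ b′ → c ≡ c′ → d ≡ d′ → e ≡ e′ → f ≡ f′ →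
          Monomials.N₂ a b c d e f ≡ Monomials.N₂ a′ b′ c′ d′ e′ f′
        N₂-cong refl refl refl refl refl refl = refl
      α₁≡ : α₁ ≡ α₁′
      α₁≡ = ℤ.*-cancelˡ-≡ (+ X.N₂) α₁ α₁′ {{A.N₂≢0}}
        (trans (component (suc (suc zero))) (cong (λ n → + n ℤ.* α₁′) (sym N₂≡)))

    Ψℕ-injective : param η₁ η₂ η₃ η₄ η₅ η₆ α₁ α₂ α₃ ≡ param η₁′ η₂′ η₃′ η₄′ η₅′ η₆′ α₁′ α₂′ α₃′
    Ψℕ-injective = cong₂ _,_
      (cong₂ _∷_ (cong +_ η₁≡) (cong₂ _∷_ (cong +_ η₂≡) (cong₂ _∷_ (cong +_ η₃≡) (cong₂ _∷_ (cong +_ η₄≡)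
        (cong₂ _∷_ (cong +_ η₅≡) (cong₂ _∷_ (cong +_ η₆≡) refl))))))
      (cong₂ _∷_ α₁≡ (cong₂ _∷_ α₂≡ (cong₂ _∷_ α₃≡ refl)))

module Descent where
  open Arithmetic
  open Parametrisation using (module Monomials; Admissible; x≡-[y+z]⇒x+y+z≡0; i*i≡+∣i∣*∣i∣; _⟨*_)
  open import Data.Nat as ℕ using (ℕ; _*_; NonZero)
  import Data.Nat.Properties as ℕ
  open import Data.Nat.Divisibility using (_∣_; divides; m∣m*n; n∣m*n; ∣m⇒∣m*n)
  open import Data.Nat.Coprimality as C using (Coprime)
  open import Data.Integer as ℤ using (ℤ; +_; ∣_∣)
  import Data.Integer.Properties as ℤ
  import Data.Integer.Divisibility.Signed as ℤ∣
  open import Data.Vec using (_∷_; [])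
  open import Data.Product using (Σ-syntax; _×_; _,_)
  open import Relation.Binary.PropositionalEquality
  open import Algebra.Solver.CommutativeMonoid ℕ.*-1-commutativeMonoid using (solve; _⊜_)

  private
    regroup₀ : ∀ m′ w′ η₂ → η₂ * η₂ * (m′ * w′) ≡ m′ * η₂ * (w′ * η₂)
    regroup₀ = solve 3 (λ m′ w′ η₂ → η₂ · η₂ · (m′ · w′) ⊜ m′ · η₂ · (w′ · η₂)) refl

    regroup₁ : ∀ u′ v′ m η₃ η₄ w → η₃ * η₃ * η₄ * η₄ * (η₃ * η₃ * η₄ * η₄) * (u′ * (m * m * m * v′ * w))
      ≡ m * η₄ * η₃ * (m * η₄ * η₃) * (m * η₄ * η₃) * (u′ * η₃) * (v′ * η₄) * w
    regroup₁ = solve 6 (λ u′ v′ m η₃ η₄ w → η₃ · η₃ · η₄ · η₄ · (η₃ · η₃ · η₄ · η₄) · (u′ · (m · m · m · v′ · w))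
      ⊜ m · η₄ · η₃ · (m · η₄ · η₃) · (m · η₄ · η₃) · (u′ · η₃) · (v′ · η₄) · w) refl

    regroup₂ : ∀ v′ m w → v′ * (m * m * m * w) ≡ m * m * m * v′ * w
    regroup₂ = solve 3 (λ v′ m w → v′ · (m · m · m · w) ⊜ m · m · m · v′ · w) refl

    regroup₃ : ∀ m w → m * m * (m * w) ≡ m * m * m * w
    regroup₃ = solve 2 (λ m w → m · m · (m · w) ⊜ m · m · m · w) refl

  opaque
    square-of-product : ∀ m w {s} → {{NonZero m}} → m * w ≡ s * s →
      Σ[ η₁ ∈ ℕ ] Σ[ η₂ ∈ ℕ ] Σ[ b ∈ ℕ ] NonZero η₁ × NonZero η₂ ×
        m ≡ η₁ * η₁ * η₂ × w ≡ b * b * η₂ × s ≡ η₂ * (η₁ * b) × Coprime (η₁ * η₁) (b * b)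
    square-of-product m w {s} {{m≢0}} mw≡s²
      with gcd-factorisation m w
    ... | m′ , w′ , η₂ , η₂≢0 , refl , refl , m′⊥w′
      with square-quotient η₂ {m′ * w′} {s} {{η₂≢0}} (trans (regroup₀ m′ w′ η₂) mw≡s²)
    ... | s′ , refl , m′w′≡s′²
      with coprime-product-square {m′} {w′} {s′} {{nonZeroˡ m′ m≢0}} m′⊥w′ m′w′≡s′²
    ... | η₁ , b , refl , refl , refl = η₁ , η₂ , b , nonZeroˡ η₁ (nonZeroˡ (η₁ * η₁) m≢0) , η₂≢0 , refl , refl , refl , m′⊥w′

  record SquareDescent (u v g w c : ℕ) : Set where
    field
      η₁ η₂ η₃ η₄ η₅ η₆ b : ℕ
      η₁≢0 : NonZero η₁
      η₂≢0 : NonZero η₂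
      η₃≢0 : NonZero η₃
      η₄≢0 : NonZero η₄
      η₅≢0 : NonZero η₅
      η₆≢0 : NonZero η₆
      u≡U : u ≡ η₃ * η₅ * η₅
      v≡V : v ≡ η₄ * η₆ * η₆
      g≡G : g ≡ η₁ * η₁ * η₂ * η₃ * η₄
      w≡η₂b² : w ≡ η₂ * b * b
      c≡N₂b : c ≡ Monomials.N₂ η₁ η₂ η₃ η₄ η₅ η₆ * b
      η₅²⊥η₁²η₂η₄ : Coprime (η₅ * η₅) (η₁ * η₁ * η₂ * η₄)
      η₆²⊥η₁²η₂ : Coprime (η₆ * η₆) (η₁ * η₁ * η₂)
      η₁²⊥b² : Coprime (η₁ * η₁) (b * b)

  -- η₃ = gcd(u, g) and η₄ = gcd(v, g/η₃); the cofactors u/η₃ and v/η₄ are coprime to the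
  -- rest of c², hence squares η₅², η₆², and what remains, (g/(η₃η₄))·w, is a square too.
  opaque
    square-descent : ∀ u v g w {c} → {{NonZero u}} → {{NonZero v}} → {{NonZero g}} →
      Coprime u v → Coprime u w → Coprime v w → c * c ≡ g * g * g * u * v * w → SquareDescent u v g w c
    square-descent u v g w {c} {{u≢0}} {{v≢0}} {{g≢0}} u⊥v u⊥w v⊥w c²≡g³uvw
      with gcd-factorisation u g
    ... | u′ , g′ , η₃ , η₃≢0 , refl , refl , u′⊥g′
      with gcd-factorisation v g′
    ... | v′ , m , η₄ , η₄≢0 , refl , refl , v′⊥m
      with square-quotient (η₃ * η₃ * η₄ * η₄) {u′ * (m * m * m * v′ * w)} {c}
             {{η₃≢0 *≢0 η₃≢0 *≢0 η₄≢0 *≢0 η₄≢0}} (trans (regroup₁ u′ v′ m η₃ η₄ w) (sym c²≡g³uvw))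
    ... | s₁ , refl , s₁²
      with coprime-product-square {u′} {m * m * m * v′ * w} {s₁} {{nonZeroˡ u′ u≢0}} u′⊥m³v′w s₁²
      where
      u′⊥m : Coprime u′ m
      u′⊥m = coprime-∣ʳ u′⊥g′ (m∣m*n η₄)
      u′⊥m³v′w : Coprime u′ (m * m * m * v′ * w)
      u′⊥m³v′w = coprime-*ʳ (coprime-*ʳ (coprime-*ʳ (coprime-*ʳ u′⊥m u′⊥m) u′⊥m)
        (coprime-∣ˡ (coprime-∣ʳ u⊥v (m∣m*n η₄)) (m∣m*n η₃))) (coprime-∣ˡ u⊥w (m∣m*n η₃))
    ... | η₅ , s₂ , refl , s₂² , refl
      with coprime-product-square {v′} {m * m * m * w} {s₂} {{nonZeroˡ v′ v≢0}} v′⊥m³w (trans (regroup₂ v′ m w) s₂²)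
      where
      v′⊥m³w : Coprime v′ (m * m * m * w)
      v′⊥m³w = coprime-*ʳ (coprime-*ʳ (coprime-*ʳ v′⊥m v′⊥m) v′⊥m) (coprime-∣ˡ v⊥w (m∣m*n η₄))
    ... | η₆ , s₃ , refl , s₃² , refl
      with square-quotient m {m * w} {s₃} {{m≢0}} (trans (regroup₃ m w) s₃²)
      where
      m≢0 : NonZero m
      m≢0 = nonZeroˡ m (nonZeroˡ (m * η₄) g≢0)
    ... | s₄ , refl , mw≡s₄²
      with square-of-product m w {s₄} {{nonZeroˡ m (nonZeroˡ (m * η₄) g≢0)}} mw≡s₄²
    ... | η₁ , η₂ , b , η₁≢0 , η₂≢0 , refl , refl , refl , η₁²⊥b² = record
      { η₁ = η₁ ; η₂ = η₂ ; η₃ = η₃ ; η₄ = η₄ ; η₅ = η₅ ; η₆ = η₆ ; b = b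
      ; η₁≢0 = η₁≢0 ; η₂≢0 = η₂≢0 ; η₃≢0 = η₃≢0 ; η₄≢0 = η₄≢0
      ; η₅≢0 = nonZeroˡ η₅ (nonZeroˡ (η₅ * η₅) u≢0) ; η₆≢0 = nonZeroˡ η₆ (nonZeroˡ (η₆ * η₆) v≢0)
      ; u≡U = solve 2 (λ η₃ η₅ → η₅ · η₅ · η₃ ⊜ η₃ · η₅ · η₅) refl η₃ η₅
      ; v≡V = solve 2 (λ η₄ η₆ → η₆ · η₆ · η₄ ⊜ η₄ · η₆ · η₆) refl η₄ η₆
      ; g≡G = solve 4 (λ η₁ η₂ η₃ η₄ → η₁ · η₁ · η₂ · η₄ · η₃ ⊜ η₁ · η₁ · η₂ · η₃ · η₄) refl η₁ η₂ η₃ η₄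
      ; w≡η₂b² = solve 2 (λ η₂ b → b · b · η₂ ⊜ η₂ · b · b) refl η₂ b
      ; c≡N₂b = solve 7 (λ η₁ η₂ η₃ η₄ η₅ η₆ b →
          η₃ · η₃ · η₄ · η₄ · (η₅ · (η₆ · (η₁ · η₁ · η₂ · (η₂ · (η₁ · b)))))
          ⊜ η₁ ^ᵉ 3 · η₂ ^ᵉ 2 · η₃ ^ᵉ 2 · η₄ ^ᵉ 2 · η₅ · η₆ · b) refl η₁ η₂ η₃ η₄ η₅ η₆ b
      ; η₅²⊥η₁²η₂η₄ = u′⊥g′ ; η₆²⊥η₁²η₂ = v′⊥m ; η₁²⊥b² = η₁²⊥b²
      }

  descent-admissible : ∀ {η₁ η₂ η₃ η₄ η₅ η₆ α₁ α₂ α₃} →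
    NonZero η₁ → NonZero η₂ → NonZero η₃ → NonZero η₄ → NonZero η₅ → NonZero η₆ →
    let U = η₃ * η₅ * η₅ ; V = η₄ * η₆ * η₆ ; G = η₁ * η₁ * η₂ * η₃ * η₄ ; W = η₂ * ∣ α₁ ∣ * ∣ α₁ ∣ in
    Coprime U V → Coprime U W → Coprime V W → Coprime ∣ α₂ ∣ (V * G) → Coprime ∣ α₃ ∣ (U * G) →
    Coprime (η₅ * η₅) (η₁ * η₁ * η₂ * η₄) → Coprime (η₆ * η₆) (η₁ * η₁ * η₂) → Coprime (η₁ * η₁) (∣ α₁ ∣ * ∣ α₁ ∣) →
    + W ≡ ℤ.- (+ U ℤ.* α₂ ℤ.+ + V ℤ.* α₃) → Admissible η₁ η₂ η₃ η₄ η₅ η₆ α₁ α₂ α₃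
  descent-admissible {η₁} {η₂} {η₃} {η₄} {η₅} {η₆} {α₁} {α₂} {α₃} η₁≢0 η₂≢0 η₃≢0 η₄≢0 η₅≢0 η₆≢0
    U⊥V U⊥W V⊥W α₂⊥VG α₃⊥UG η₅²⊥η₁²η₂η₄ η₆²⊥η₁²η₂ η₁²⊥α₁² W≡ = record
    { η₁≢0 = η₁≢0 ; η₂≢0 = η₂≢0 ; η₃≢0 = η₃≢0 ; η₄≢0 = η₄≢0 ; η₅≢0 = η₅≢0 ; η₆≢0 = η₆≢0
    ; torsor = x≡-[y+z]⇒x+y+z≡0 (+ η₂ ℤ.* α₁ ℤ.* α₁) (+ η₃ ℤ.* + η₅ ℤ.* + η₅ ℤ.* α₂) (+ η₄ ℤ.* + η₆ ℤ.* + η₆ ℤ.* α₃)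
        (trans +η₂α₁²≡+W (trans W≡ (cong₂ (λ u v → ℤ.- (u ℤ.* α₂ ℤ.+ v ℤ.* α₃))
          (ℤ.pos-* η₃ η₅ ⟨* η₅) (ℤ.pos-* η₄ η₆ ⟨* η₆))))
    ; η₁⊥η₅ = C.sym (coprime-∣ η₅²⊥η₁²η₂η₄ (m∣m*n η₅) (∣m⇒∣m*n η₄ (∣m⇒∣m*n η₂ (m∣m*n η₁))))
    ; η₁⊥η₆ = C.sym (coprime-∣ η₆²⊥η₁²η₂ (m∣m*n η₆) (∣m⇒∣m*n η₂ (m∣m*n η₁)))
    ; η₂⊥η₃ = C.sym (coprime-∣ U⊥W η₃∣U η₂∣W)
    ; η₂⊥η₄ = C.sym (coprime-∣ V⊥W η₄∣V η₂∣W)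
    ; η₂⊥η₅ = C.sym (coprime-∣ U⊥W η₅∣U η₂∣W)
    ; η₂⊥η₆ = C.sym (coprime-∣ V⊥W η₆∣V η₂∣W)
    ; η₃⊥η₄ = coprime-∣ U⊥V η₃∣U η₄∣V
    ; η₃⊥η₆ = coprime-∣ U⊥V η₃∣U η₆∣V
    ; η₄⊥η₅ = C.sym (coprime-∣ U⊥V η₅∣U η₄∣V)
    ; η₅⊥η₆ = coprime-∣ U⊥V η₅∣U η₆∣V
    ; α₁⊥η = coprime-*ʳ (coprime-*ʳ (coprime-*ʳ (coprime-*ʳ
        (C.sym (coprime-∣ η₁²⊥α₁² (m∣m*n {η₁} η₁) (m∣m*n {∣ α₁ ∣} ∣ α₁ ∣)))
        (C.sym (coprime-∣ U⊥W η₃∣U α₁∣W))) (C.sym (coprime-∣ V⊥W η₄∣V α₁∣W)))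
        (C.sym (coprime-∣ U⊥W η₅∣U α₁∣W))) (C.sym (coprime-∣ V⊥W η₆∣V α₁∣W))
    ; α₂⊥η = coprime-∣ʳ α₂⊥VG (divides (η₁ * η₄ * η₆) (solve 5 (λ η₁ η₂ η₃ η₄ η₆ →
        η₄ · η₆ · η₆ · (η₁ · η₁ · η₂ · η₃ · η₄) ⊜ η₁ · η₄ · η₆ · (η₁ · η₂ · η₃ · η₄ · η₆)) refl η₁ η₂ η₃ η₄ η₆))
    ; α₃⊥η = coprime-∣ʳ α₃⊥UG (divides (η₁ * η₃ * η₅) (solve 5 (λ η₁ η₂ η₃ η₄ η₅ →
        η₃ · η₅ · η₅ · (η₁ · η₁ · η₂ · η₃ · η₄) ⊜ η₁ · η₃ · η₅ · (η₁ · η₂ · η₃ · η₄ · η₅)) refl η₁ η₂ η₃ η₄ η₅))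
    }
    where
    η₃∣U = ∣m⇒∣m*n η₅ (m∣m*n η₅)
    η₅∣U = n∣m*n (η₃ * η₅)
    η₄∣V = ∣m⇒∣m*n η₆ (m∣m*n η₆)
    η₆∣V = n∣m*n (η₄ * η₆)
    η₂∣W = ∣m⇒∣m*n ∣ α₁ ∣ (m∣m*n ∣ α₁ ∣)
    α₁∣W = n∣m*n (η₂ * ∣ α₁ ∣)
    +η₂α₁²≡+W : + η₂ ℤ.* α₁ ℤ.* α₁ ≡ + (η₂ * ∣ α₁ ∣ * ∣ α₁ ∣)
    +η₂α₁²≡+W = begin
      + η₂ ℤ.* α₁ ℤ.* α₁                ≡⟨ ℤ.*-assoc (+ η₂) α₁ α₁ ⟩
      + η₂ ℤ.* (α₁ ℤ.* α₁)              ≡⟨ cong (+ η₂ ℤ.*_) (i*i≡+∣i∣*∣i∣ α₁) ⟩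
      + η₂ ℤ.* + (∣ α₁ ∣ * ∣ α₁ ∣)      ≡⟨ ℤ.pos-* η₂ (∣ α₁ ∣ * ∣ α₁ ∣) ⟨
      + (η₂ * (∣ α₁ ∣ * ∣ α₁ ∣))        ≡⟨ cong +_ (ℕ.*-assoc η₂ ∣ α₁ ∣ ∣ α₁ ∣) ⟨
      + (η₂ * ∣ α₁ ∣ * ∣ α₁ ∣)          ∎
      where open ≡-Reasoning

  record Preimage (y : Pt) : Set where
    field
      η₁ η₂ η₃ η₄ η₅ η₆ : ℕ
      α₁ α₂ α₃ : ℤ
      admissible : Admissible η₁ η₂ η₃ η₄ η₅ η₆ α₁ α₂ α₃
      Ψℕ≡y : Monomials.Ψℕ η₁ η₂ η₃ η₄ η₅ η₆ α₁ α₂ α₃ ≡ y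

  opaque
    signed-quotient : ∀ y n {b} → {{NonZero n}} → ∣ y ∣ ≡ n * b → Σ[ α ∈ ℤ ] y ≡ + n ℤ.* α × ∣ α ∣ ≡ b
    signed-quotient y n {b} ∣y∣≡nb with ℤ∣.∣ᵤ⇒∣ {+ n} {y} (divides b (trans ∣y∣≡nb (ℕ.*-comm n b)))
    ... | ℤ∣.divides α y≡αn = α , trans y≡αn (ℤ.*-comm α (+ n)) ,
      ℕ.*-cancelʳ-≡ ∣ α ∣ b n (trans (sym (ℤ.abs-* α (+ n))) (trans (cong ∣_∣ (sym y≡αn)) (trans ∣y∣≡nb (ℕ.*-comm n b))))

  descent-preimage : ∀ u v g w α₂ α₃ y₂ → {{NonZero u}} → {{NonZero v}} → {{NonZero g}} →
    Coprime u v → Coprime u w → Coprime v w → Coprime ∣ α₂ ∣ (v * g) → Coprime ∣ α₃ ∣ (u * g) →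
    + w ≡ ℤ.- (+ u ℤ.* α₂ ℤ.+ + v ℤ.* α₃) → ∣ y₂ ∣ * ∣ y₂ ∣ ≡ g * g * g * u * v * w →
    Preimage (+ (u * g) ℤ.* α₂ ∷ + (u * g * (v * g)) ∷ y₂ ∷ + (v * g) ℤ.* α₃ ∷ α₂ ℤ.* α₃ ∷ [])
  descent-preimage u v g w α₂ α₃ y₂ u⊥v u⊥w v⊥w α₂⊥vg α₃⊥ug w≡ y₂²≡ with square-descent u v g w {∣ y₂ ∣} u⊥v u⊥w v⊥w y₂²≡
  ... | record { η₁ = η₁ ; η₂ = η₂ ; η₃ = η₃ ; η₄ = η₄ ; η₅ = η₅ ; η₆ = η₆ ; b = b
               ; η₁≢0 = η₁≢0 ; η₂≢0 = η₂≢0 ; η₃≢0 = η₃≢0 ; η₄≢0 = η₄≢0 ; η₅≢0 = η₅≢0 ; η₆≢0 = η₆≢0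
               ; u≡U = refl ; v≡V = refl ; g≡G = refl ; w≡η₂b² = refl ; c≡N₂b = ∣y₂∣≡N₂b
               ; η₅²⊥η₁²η₂η₄ = η₅²⊥η₁²η₂η₄ ; η₆²⊥η₁²η₂ = η₆²⊥η₁²η₂ ; η₁²⊥b² = η₁²⊥b² }
      with signed-quotient y₂ (Monomials.N₂ η₁ η₂ η₃ η₄ η₅ η₆) {{N₂≢0}} ∣y₂∣≡N₂b
    where
    N₂≢0 : NonZero (Monomials.N₂ η₁ η₂ η₃ η₄ η₅ η₆)
    N₂≢0 = ℕ.m^n≢0 η₁ 3 {{η₁≢0}} *≢0 ℕ.m^n≢0 η₂ 2 {{η₂≢0}} *≢0 ℕ.m^n≢0 η₃ 2 {{η₃≢0}} *≢0 ℕ.m^n≢0 η₄ 2 {{η₄≢0}}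
           *≢0 η₅≢0 *≢0 η₆≢0
  ... | α₁ , refl , refl = record
    { η₁ = η₁ ; η₂ = η₂ ; η₃ = η₃ ; η₄ = η₄ ; η₅ = η₅ ; η₆ = η₆ ; α₁ = α₁ ; α₂ = α₂ ; α₃ = α₃
    ; admissible = descent-admissible η₁≢0 η₂≢0 η₃≢0 η₄≢0 η₅≢0 η₆≢0 u⊥v u⊥w v⊥w α₂⊥vg α₃⊥ug
        η₅²⊥η₁²η₂η₄ η₆²⊥η₁²η₂ η₁²⊥b² w≡
    ; Ψℕ≡y = cong₂ _∷_ (cong (λ n → + n ℤ.* α₂) N₀≡UG) (cong₂ _∷_ (cong +_ (trans N₁≡N₀N₃ (cong₂ _*_ N₀≡UG N₃≡VG)))
        (cong₂ _∷_ refl (cong₂ _∷_ (cong (λ n → + n ℤ.* α₃) N₃≡VG) refl)))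
    }
    where open Monomials η₁ η₂ η₃ η₄ η₅ η₆

module Surjectivity where
  open Arithmetic
  open PrimitiveVectors
  open Parametrisation
  open Descent
  open import Data.Nat as ℕ using (ℕ; suc; _*_; NonZero)
  import Data.Nat.Properties as ℕ
  open import Data.Nat.Divisibility using (_∣_; divides; ∣m⇒∣m*n; ∣n⇒∣m*n; *-pres-∣)
  open import Data.Nat.Coprimality as C using (Coprime; coprime-divisor)
  open import Data.Integer as ℤ using (ℤ; +_; -[1+_]; ∣_∣; 0ℤ)
  import Data.Integer.Properties as ℤ
  import Data.Integer.Divisibility.Signed as ℤ∣
  import Data.Integer.Tactic.RingSolver as ZS
  open import Data.Vec using (_∷_; []; map)
  open import Data.Sum using ([_,_]′)
  open import Data.Vec.Relation.Unary.All using (_∷_; [])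
  open import Data.Product using (Σ-syntax; _×_; _,_)
  open import Relation.Binary.PropositionalEquality
  open import Algebra.Solver.CommutativeMonoid ℕ.*-1-commutativeMonoid using (solve; _⊜_)

  opaque
    quadric₁-shape : ∀ A C α₂ y₃ y₄ → {{NonZero A}} → {{NonZero C}} → Coprime C ∣ α₂ ∣ →
      + A ℤ.* α₂ ℤ.* y₃ ℤ.- + (C * A) ℤ.* y₄ ≡ 0ℤ → Σ[ α₃ ∈ ℤ ] y₃ ≡ + C ℤ.* α₃ × y₄ ≡ α₂ ℤ.* α₃
    quadric₁-shape A C α₂ y₃ y₄ C⊥α₂ quadric = shape (ℤ∣.∣ᵤ⇒∣ C∣y₃)
      where
      open ≡-Reasoning
      factor : ∀ a c α y₃ y₄ → a ℤ.* α ℤ.* y₃ ℤ.- c ℤ.* a ℤ.* y₄ ≡ a ℤ.* (α ℤ.* y₃) ℤ.- a ℤ.* (c ℤ.* y₄)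
      factor = ZS.solve-∀
      α₂y₃≡Cy₄ : α₂ ℤ.* y₃ ≡ + C ℤ.* y₄
      α₂y₃≡Cy₄ = ℤ.*-cancelˡ-≡ (+ A) (α₂ ℤ.* y₃) (+ C ℤ.* y₄) (ℤ.i-j≡0⇒i≡j _ _ (trans
        (sym (factor (+ A) (+ C) α₂ y₃ y₄)) (trans (cong (λ ca → + A ℤ.* α₂ ℤ.* y₃ ℤ.- ca ℤ.* y₄) (sym (ℤ.pos-* C A))) quadric)))
      C∣y₃ : C ∣ ∣ y₃ ∣
      C∣y₃ = coprime-divisor C⊥α₂ (divides ∣ y₄ ∣ (begin
        ∣ α₂ ∣ * ∣ y₃ ∣      ≡⟨ ℤ.abs-* α₂ y₃ ⟨
        ∣ α₂ ℤ.* y₃ ∣        ≡⟨ cong ∣_∣ α₂y₃≡Cy₄ ⟩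
        ∣ + C ℤ.* y₄ ∣       ≡⟨ ℤ.abs-* (+ C) y₄ ⟩
        C * ∣ y₄ ∣           ≡⟨ ℕ.*-comm C ∣ y₄ ∣ ⟩
        ∣ y₄ ∣ * C           ∎))
      swap : ∀ a c b → a ℤ.* (c ℤ.* b) ≡ c ℤ.* (a ℤ.* b)
      swap = ZS.solve-∀
      shape : + C ℤ∣.∣ y₃ → Σ[ α₃ ∈ ℤ ] y₃ ≡ + C ℤ.* α₃ × y₄ ≡ α₂ ℤ.* α₃
      shape (ℤ∣.divides α₃ y₃≡α₃C) = α₃ , y₃≡Cα₃ , ℤ.*-cancelˡ-≡ (+ C) y₄ (α₂ ℤ.* α₃) (begin
        + C ℤ.* y₄               ≡⟨ α₂y₃≡Cy₄ ⟨
        α₂ ℤ.* y₃                ≡⟨ cong (α₂ ℤ.*_) y₃≡Cα₃ ⟩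
        α₂ ℤ.* (+ C ℤ.* α₃)      ≡⟨ swap α₂ (+ C) α₃ ⟩
        + C ℤ.* (α₂ ℤ.* α₃)      ∎)
        where
        y₃≡Cα₃ : y₃ ≡ + C ℤ.* α₃
        y₃≡Cα₃ = trans y₃≡α₃C (ℤ.*-comm α₃ (+ C))

  square-cofactor : ∀ y k W → {{NonZero k}} → y ℤ.* y ≡ + k ℤ.* W → W ≡ + ∣ W ∣ × ∣ y ∣ * ∣ y ∣ ≡ k * ∣ W ∣
  square-cofactor y k W y²≡kW = W≡+∣W∣ k W y²≡kW , ℤ.+-injective (begin
    + (∣ y ∣ * ∣ y ∣)   ≡⟨ i*i≡+∣i∣*∣i∣ y ⟨
    y ℤ.* y             ≡⟨ y²≡kW ⟩
    + k ℤ.* W           ≡⟨ cong (+ k ℤ.*_) (W≡+∣W∣ k W y²≡kW) ⟩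
    + k ℤ.* + ∣ W ∣     ≡⟨ ℤ.pos-* k ∣ W ∣ ⟨
    + (k * ∣ W ∣)       ∎)
    where
    open ≡-Reasoning
    W≡+∣W∣ : ∀ k W → {{NonZero k}} → y ℤ.* y ≡ + k ℤ.* W → W ≡ + ∣ W ∣
    W≡+∣W∣ k       (+ _)    _     = refl
    W≡+∣W∣ (suc _) -[1+ n ] y²≡kW with () ← trans (sym (i*i≡+∣i∣*∣i∣ y)) y²≡kW

  opaque
    quadric₂-weight : ∀ u v g α₂ α₃ y₂ → {{NonZero u}} → {{NonZero v}} → {{NonZero g}} →
      + (u * g) ℤ.* α₂ ℤ.* + (v * g * (u * g)) ℤ.+ + (v * g * (u * g)) ℤ.* (+ (v * g) ℤ.* α₃) ℤ.+ y₂ ℤ.* y₂ ≡ 0ℤ →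
      Σ[ w ∈ ℕ ] + w ≡ ℤ.- (+ u ℤ.* α₂ ℤ.+ + v ℤ.* α₃) × ∣ y₂ ∣ * ∣ y₂ ∣ ≡ g * g * g * u * v * w
    quadric₂-weight u v g α₂ α₃ y₂ {{u≢0}} {{v≢0}} {{g≢0}} quadric =
      ∣ W ∣ , sym W≡+∣W∣ , ∣y₂∣²≡
      where
      open ≡-Reasoning
      W a b : ℤ
      W = ℤ.- (+ u ℤ.* α₂ ℤ.+ + v ℤ.* α₃)
      a = + (u * g) ℤ.* α₂ ℤ.* + (v * g * (u * g))
      b = + (v * g * (u * g)) ℤ.* (+ (v * g) ℤ.* α₃)
      rotate : ∀ a b c → c ℤ.+ a ℤ.+ b ≡ a ℤ.+ b ℤ.+ c
      rotate = ZS.solve-∀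
      expand : ∀ u v g α₂ α₃ → ℤ.- (u ℤ.* g ℤ.* α₂ ℤ.* (v ℤ.* g ℤ.* (u ℤ.* g)) ℤ.+ v ℤ.* g ℤ.* (u ℤ.* g) ℤ.* (v ℤ.* g ℤ.* α₃))
        ≡ g ℤ.* g ℤ.* g ℤ.* u ℤ.* v ℤ.* ℤ.- (u ℤ.* α₂ ℤ.+ v ℤ.* α₃)
      expand = ZS.solve-∀
      y₂²≡KW : y₂ ℤ.* y₂ ≡ + (g * g * g * u * v) ℤ.* W
      y₂²≡KW = begin
        y₂ ℤ.* y₂
          ≡⟨ x+y+z≡0⇒x≡-[y+z] (y₂ ℤ.* y₂) a b (trans (rotate a b (y₂ ℤ.* y₂)) quadric) ⟩
        ℤ.- (a ℤ.+ b)
          ≡⟨ cong₃ (λ ug vg vgug → ℤ.- (ug ℤ.* α₂ ℤ.* vgug ℤ.+ vgug ℤ.* (vg ℤ.* α₃)))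
                   (ℤ.pos-* u g) (ℤ.pos-* v g) (ℤ.pos-* v g ⟨*⟩ ℤ.pos-* u g) ⟩
        ℤ.- (+ u ℤ.* + g ℤ.* α₂ ℤ.* (+ v ℤ.* + g ℤ.* (+ u ℤ.* + g)) ℤ.+ + v ℤ.* + g ℤ.* (+ u ℤ.* + g) ℤ.* (+ v ℤ.* + g ℤ.* α₃))
          ≡⟨ expand (+ u) (+ v) (+ g) α₂ α₃ ⟩
        + g ℤ.* + g ℤ.* + g ℤ.* + u ℤ.* + v ℤ.* W
          ≡⟨ cong (ℤ._* W) (ℤ.pos-* g g ⟨* g ⟨* u ⟨* v) ⟨
        + (g * g * g * u * v) ℤ.* W ∎
        where
        cong₃ : ∀ {A : Set} (f : A → A → A → ℤ) {x x′ y y′ z z′} → x ≡ x′ → y ≡ y′ → z ≡ z′ → f x y z ≡ f x′ y′ z′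
        cong₃ f refl refl refl = refl
      cofactor : W ≡ + ∣ W ∣ × ∣ y₂ ∣ * ∣ y₂ ∣ ≡ g * g * g * u * v * ∣ W ∣
      cofactor = square-cofactor y₂ (g * g * g * u * v) W {{g≢0 *≢0 g≢0 *≢0 g≢0 *≢0 u≢0 *≢0 v≢0}} y₂²≡KW
      W≡+∣W∣ : W ≡ + ∣ W ∣
      W≡+∣W∣ = Data.Product.proj₁ cofactor
      ∣y₂∣²≡ : ∣ y₂ ∣ * ∣ y₂ ∣ ≡ g * g * g * u * v * ∣ W ∣
      ∣y₂∣²≡ = Data.Product.proj₂ cofactor

  private
    ∣-abs-+ : ∀ {c} a b → c ∣ ∣ a ∣ → c ∣ ∣ b ∣ → c ∣ ∣ a ℤ.+ b ∣
    ∣-abs-+ {c} a b c∣a c∣b = ℤ∣.∣⇒∣ᵤ (ℤ∣.∣m∣n⇒∣m+n (ℤ∣.∣ᵤ⇒∣ {+ c} {a} c∣a) (ℤ∣.∣ᵤ⇒∣ {+ c} {b} c∣b))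

    ∣-abs-neg : ∀ {c} a → c ∣ ∣ a ∣ → c ∣ ∣ ℤ.- a ∣
    ∣-abs-neg a c∣a = subst (_ ∣_) (sym (ℤ.∣-i∣≡∣i∣ a)) c∣a

    ∣-abs-*ˡ : ∀ {c} n a → c ∣ n → c ∣ ∣ + n ℤ.* a ∣
    ∣-abs-*ˡ n a c∣n = subst (_ ∣_) (sym (ℤ.abs-* (+ n) a)) (∣m⇒∣m*n ∣ a ∣ c∣n)

    ∣-abs-*ʳ : ∀ {c} m a → c ∣ ∣ a ∣ → c ∣ ∣ m ℤ.* a ∣
    ∣-abs-*ʳ m a c∣a = subst (_ ∣_) (sym (ℤ.abs-* m a)) (∣n⇒∣m*n ∣ m ∣ c∣a)

    rotate : ∀ a b c → c ℤ.+ a ℤ.+ b ≡ a ℤ.+ b ℤ.+ c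
    rotate = ZS.solve-∀

  primitive-coprimality : ∀ u v g w α₂ α₃ y₂ → Coprime u v → Coprime (v * g) ∣ α₂ ∣ →
    + w ≡ ℤ.- (+ u ℤ.* α₂ ℤ.+ + v ℤ.* α₃) → ∣ y₂ ∣ * ∣ y₂ ∣ ≡ g * g * g * u * v * w →
    Primitive (+ (u * g) ℤ.* α₂ ∷ + (v * g * (u * g)) ∷ y₂ ∷ + (v * g) ℤ.* α₃ ∷ α₂ ℤ.* α₃ ∷ []) →
    Coprime ∣ α₃ ∣ (u * g) × Coprime u w × Coprime v w
  primitive-coprimality u v g w α₂ α₃ y₂ u⊥v vg⊥α₂ w≡ y₂²≡ prim = α₃⊥ug , u⊥w , v⊥w
    where
    open ≡-Reasoning
    +gw≡ : + (g * w) ≡ ℤ.- (+ (u * g) ℤ.* α₂ ℤ.+ + (v * g) ℤ.* α₃)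
    +gw≡ = begin
      + (g * w)                                   ≡⟨ ℤ.pos-* g w ⟩
      + g ℤ.* + w                                 ≡⟨ cong (+ g ℤ.*_) w≡ ⟩
      + g ℤ.* ℤ.- (+ u ℤ.* α₂ ℤ.+ + v ℤ.* α₃)     ≡⟨ distribute (+ u) (+ v) (+ g) α₂ α₃ ⟩
      ℤ.- (+ u ℤ.* + g ℤ.* α₂ ℤ.+ + v ℤ.* + g ℤ.* α₃)
        ≡⟨ cong₂ (λ ug vg → ℤ.- (ug ℤ.* α₂ ℤ.+ vg ℤ.* α₃)) (ℤ.pos-* u g) (ℤ.pos-* v g) ⟨
      ℤ.- (+ (u * g) ℤ.* α₂ ℤ.+ + (v * g) ℤ.* α₃)  ∎
      where
      distribute : ∀ u v g α₂ α₃ → g ℤ.* ℤ.- (u ℤ.* α₂ ℤ.+ v ℤ.* α₃) ≡ ℤ.- (u ℤ.* g ℤ.* α₂ ℤ.+ v ℤ.* g ℤ.* α₃)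
      distribute = ZS.solve-∀
    α₃⊥ug : Coprime ∣ α₃ ∣ (u * g)
    α₃⊥ug {c} (c∣α₃ , c∣ug) = prim
      (∣-abs-*ˡ (u * g) α₂ c∣ug ∷ ∣n⇒∣m*n (v * g) c∣ug ∷ c∣y₂ ∷ ∣-abs-*ʳ (+ (v * g)) α₃ c∣α₃ ∷ ∣-abs-*ʳ α₂ α₃ c∣α₃ ∷ [])
      where
      c∣gw : c ∣ g * w
      c∣gw = subst (c ∣_) (cong ∣_∣ (sym +gw≡))
        (∣-abs-neg (+ (u * g) ℤ.* α₂ ℤ.+ + (v * g) ℤ.* α₃) (∣-abs-+ (+ (u * g) ℤ.* α₂) (+ (v * g) ℤ.* α₃) (∣-abs-*ˡ (u * g) α₂ c∣ug) (∣-abs-*ʳ (+ (v * g)) α₃ c∣α₃)))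
      c∣y₂ : c ∣ ∣ y₂ ∣
      c∣y₂ = m*m∣n*n⇒m∣n (subst (c * c ∣_) (trans (regroup u v g w) (sym y₂²≡)) (∣m⇒∣m*n (v * g) (*-pres-∣ c∣ug c∣gw)))
        where
        regroup : ∀ u v g w → u * g * (g * w) * (v * g) ≡ g * g * g * u * v * w
        regroup = solve 4 (λ u v g w → u · g · (g · w) · (v · g) ⊜ g · g · g · u · v · w) refl
    +vα₃≡ : + v ℤ.* α₃ ≡ ℤ.- (+ w ℤ.+ + u ℤ.* α₂)
    +vα₃≡ = x+y+z≡0⇒x≡-[y+z] (+ v ℤ.* α₃) (+ w) (+ u ℤ.* α₂)
      (trans (rotate (+ w) (+ u ℤ.* α₂) (+ v ℤ.* α₃)) (x≡-[y+z]⇒x+y+z≡0 (+ w) (+ u ℤ.* α₂) (+ v ℤ.* α₃) w≡))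
    +uα₂≡ : + u ℤ.* α₂ ≡ ℤ.- (+ v ℤ.* α₃ ℤ.+ + w)
    +uα₂≡ = x+y+z≡0⇒x≡-[y+z] (+ u ℤ.* α₂) (+ v ℤ.* α₃) (+ w)
      (trans (sym (rotate (+ u ℤ.* α₂) (+ v ℤ.* α₃) (+ w))) (x≡-[y+z]⇒x+y+z≡0 (+ w) (+ u ℤ.* α₂) (+ v ℤ.* α₃) w≡))
    u⊥w : Coprime u w
    u⊥w {c} (c∣u , c∣w) = α₃⊥ug (c∣α₃ , ∣m⇒∣m*n g c∣u)
      where
      c∣vα₃ : c ∣ v * ∣ α₃ ∣
      c∣vα₃ = subst (c ∣_) (trans (cong ∣_∣ (sym +vα₃≡)) (ℤ.abs-* (+ v) α₃))
        (∣-abs-neg (+ w ℤ.+ + u ℤ.* α₂) (∣-abs-+ (+ w) (+ u ℤ.* α₂) c∣w (∣-abs-*ˡ u α₂ c∣u)))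
      c∣α₃ : c ∣ ∣ α₃ ∣
      c∣α₃ = coprime-divisor (coprime-∣ˡ u⊥v c∣u) c∣vα₃
    v⊥w : Coprime v w
    v⊥w {c} (c∣v , c∣w) = vg⊥α₂ (∣m⇒∣m*n g c∣v , c∣α₂)
      where
      c∣uα₂ : c ∣ u * ∣ α₂ ∣
      c∣uα₂ = subst (c ∣_) (trans (cong ∣_∣ (sym +uα₂≡)) (ℤ.abs-* (+ u) α₂))
        (∣-abs-neg (+ v ℤ.* α₃ ℤ.+ + w) (∣-abs-+ (+ v ℤ.* α₃) (+ w) (∣-abs-*ˡ v α₃ c∣v) c∣w))
      c∣α₂ : c ∣ ∣ α₂ ∣
      c∣α₂ = coprime-divisor (coprime-∣ˡ (C.sym u⊥v) c∣v) c∣uα₂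

  S-preimage : ∀ y₀ Y₁ y₂ y₃ y₄ → {{NonZero Y₁}} →
    InS (y₀ ∷ + Y₁ ∷ y₂ ∷ y₃ ∷ y₄ ∷ []) → Primitive (y₀ ∷ + Y₁ ∷ y₂ ∷ y₃ ∷ y₄ ∷ []) →
    Preimage (y₀ ∷ + Y₁ ∷ y₂ ∷ y₃ ∷ y₄ ∷ [])
  S-preimage y₀ Y₁ y₂ y₃ y₄ {{Y₁≢0}} (quadric₁ , quadric₂) prim
    with gcd-factorisation Y₁ ∣ y₀ ∣
  ... | C , q , A , A≢0 , refl , ∣y₀∣≡qA , C⊥q
    with signed-quotient y₀ A {{A≢0}} (trans ∣y₀∣≡qA (ℕ.*-comm q A))
  ... | α₂ , refl , refl
    with quadric₁-shape A C α₂ y₃ y₄ {{A≢0}} {{nonZeroˡ C Y₁≢0}} C⊥q quadric₁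
  ... | α₃ , refl , refl
    with gcd-factorisation A C {{A≢0}}
  ... | u , v , g , g≢0 , refl , refl , u⊥v
    with quadric₂-weight u v g α₂ α₃ y₂ {{nonZeroˡ u A≢0}} {{nonZeroˡ v (nonZeroˡ (v * g) Y₁≢0)}} {{g≢0}} quadric₂
  ... | w , w≡ , y₂²≡
    with primitive-coprimality u v g w α₂ α₃ y₂ u⊥v C⊥q w≡ y₂²≡ prim
  ... | α₃⊥ug , u⊥w , v⊥w =
    subst Preimage (cong (λ n → + (u * g) ℤ.* α₂ ∷ + n ∷ y₂ ∷ + (v * g) ℤ.* α₃ ∷ α₂ ℤ.* α₃ ∷ []) (ℕ.*-comm (u * g) (v * g)))
      (descent-preimage u v g w α₂ α₃ y₂ {{nonZeroˡ u A≢0}} {{nonZeroˡ v (nonZeroˡ (v * g) Y₁≢0)}} {{g≢0}}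
        u⊥v u⊥w v⊥w (C.sym C⊥q) α₃⊥ug w≡ y₂²≡)

  InS-unscale : ∀ l y → l ≢ 0ℤ → InS (map (l ℤ.*_) y) → InS y
  InS-unscale l (y₀ ∷ y₁ ∷ y₂ ∷ y₃ ∷ y₄ ∷ []) l≢0 (quadric₁ , quadric₂) =
    cancel (trans (sym (factor₁ l y₀ y₁ y₃ y₄)) quadric₁) , cancel (trans (sym (factor₂ l y₀ y₁ y₂ y₃)) quadric₂)
    where
    factor₁ : ∀ l y₀ y₁ y₃ y₄ → l ℤ.* y₀ ℤ.* (l ℤ.* y₃) ℤ.- l ℤ.* y₁ ℤ.* (l ℤ.* y₄) ≡ l ℤ.* l ℤ.* (y₀ ℤ.* y₃ ℤ.- y₁ ℤ.* y₄)
    factor₁ = ZS.solve-∀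
    factor₂ : ∀ l y₀ y₁ y₂ y₃ → l ℤ.* y₀ ℤ.* (l ℤ.* y₁) ℤ.+ l ℤ.* y₁ ℤ.* (l ℤ.* y₃) ℤ.+ l ℤ.* y₂ ℤ.* (l ℤ.* y₂)
      ≡ l ℤ.* l ℤ.* (y₀ ℤ.* y₁ ℤ.+ y₁ ℤ.* y₃ ℤ.+ y₂ ℤ.* y₂)
    factor₂ = ZS.solve-∀
    cancel : ∀ {z} → l ℤ.* l ℤ.* z ≡ 0ℤ → z ≡ 0ℤ
    cancel {z} l²z≡0 = ℤ.*-cancelˡ-≡ (l ℤ.* l) z 0ℤ {{ℤ.≢-nonZero l²≢0}} (trans l²z≡0 (sym (ℤ.*-zeroʳ (l ℤ.* l))))
      where
      l²≢0 : l ℤ.* l ≢ 0ℤ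
      l²≢0 l²≡0 = [ l≢0 , l≢0 ]′ (ℤ.i*j≡0⇒i≡0∨j≡0 l l²≡0)

open Arithmetic
open Height
open PrimitiveVectors
open Parametrisation
open Injectivity
open Descent
open Surjectivity
import Data.Nat as ℕ
open import Data.Integer as ℤ using (0ℤ; 1ℤ)
import Data.Integer.Properties as ℤ
open import Data.Rational using (ℚ; 0ℚ; _<_; _≤_)
import Data.Rational.Properties as ℚ
open import Data.Vec using (_∷_; []; map; lookup)
open import Data.Vec.Properties using (map-id; map-cong)
open import Data.Fin using (zero; suc)
open import Data.Product using (Σ; _×_; _,_)
open import Relation.Binary.PropositionalEquality

Ψ-well-defined : ∀ {B} t → InT1 B t → NonZeroVec (Ψ t) × InS° (Ψ t) × H (Ψ t) ≤ B
Ψ-well-defined t t∈T₁ with InT1⇒AdmissibleParam t t∈T₁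
... | admissible {η₁} {η₂} {η₃} {η₄} {η₅} {η₆} {α₁} {α₂} {α₃} A =
  (λ Ψt≡0 → x₁≢0 (cong (λ x → lookup x (suc zero)) Ψt≡0)) ,
  (subst InS (sym (Ψ-param α₁ α₂ α₃)) (Ψℕ-on-S α₁ α₂ α₃ (Admissible.torsor A)) , x₁≢0) ,
  ℚ.≤-trans (H≤maxAbs (Ψ t) (gcdAll≢0 (Ψ t) x₁≢0)) (AllAbsLe⇒maxAbs≤ (Ψ t) (InT1-bound t t∈T₁))
  where
  open Monomials η₁ η₂ η₃ η₄ η₅ η₆
  x₁≢0 : lookup (Ψ t) (suc zero) ≢ 0ℤ
  x₁≢0 x₁≡0 = ℤ.<-irrefl (sym (trans (sym (cong (λ x → lookup x (suc zero)) (Ψ-param α₁ α₂ α₃))) x₁≡0))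
    (AdmissibleProperties.0<N₁ A)

Ψ-injective : ∀ {B} t t′ → InT1 B t → InT1 B t′ → Ψ t ∼ Ψ t′ → t ≡ t′
Ψ-injective t t′ t∈T₁ t′∈T₁ Ψt∼Ψt′ with InT1⇒AdmissibleParam t t∈T₁ | InT1⇒AdmissibleParam t′ t′∈T₁
... | admissible {η₁} {η₂} {η₃} {η₄} {η₅} {η₆} {α₁} {α₂} {α₃} A
    | admissible {η₁′} {η₂′} {η₃′} {η₄′} {η₅′} {η₆′} {α₁′} {α₂′} {α₃′} A′ =
  Ψℕ-injective A A′ (∼-primitive⇒≡ (Ψℕ-primitive A) (Ψℕ-primitive A′) (0<N₁ A) (0<N₁ A′)
    (subst₂ _∼_ (Monomials.Ψ-param η₁ η₂ η₃ η₄ η₅ η₆ α₁ α₂ α₃) (Monomials.Ψ-param η₁′ η₂′ η₃′ η₄′ η₅′ η₆′ α₁′ α₂′ α₃′) Ψt∼Ψt′))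
  where open AdmissibleProperties using (Ψℕ-primitive; 0<N₁)

Ψ-surjective : ∀ {B} x → NonZeroVec x → InS° x → H x ≤ B → Σ Param (λ t → InT1 B t × Ψ t ∼ x)
Ψ-surjective {B} x@(_ ∷ _ ∷ _ ∷ _ ∷ _ ∷ []) _ (x∈S , x₁≢0) H≤B
  with primitive-part (gcdAll x) x (suc zero) {{ℕ.≢-nonZero (gcdAll≢0 x x₁≢0)}} (gcdAll-∣ x) (∣-gcdAll x) x₁≢0
... | l , y@(y₀ ∷ _ ∷ y₂ ∷ y₃ ∷ y₄ ∷ []) , l≢0 , x≡ly , ∣l∣≡g , prim , ℤ.+<+ {n = Y₁} 0<Y₁
  with S-preimage y₀ Y₁ y₂ y₃ y₄ {{ℕ.>-nonZero 0<Y₁}} (InS-unscale l y l≢0 (subst InS x≡ly x∈S)) prim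
... | record { η₁ = η₁ ; η₂ = η₂ ; η₃ = η₃ ; η₄ = η₄ ; η₅ = η₅ ; η₆ = η₆ ; α₁ = α₁ ; α₂ = α₂ ; α₃ = α₃
             ; admissible = A ; Ψℕ≡y = Ψℕ≡y } =
  param η₁ η₂ η₃ η₄ η₅ η₆ α₁ α₂ α₃ , Admissible⇒InT1 A bound ,
  (l , 1ℤ , l≢0 , (λ ()) , trans (cong (map (l ℤ.*_)) Ψt≡y) (trans (sym x≡ly) (sym 1x≡x)))
  where
  Ψt≡y : Ψ (param η₁ η₂ η₃ η₄ η₅ η₆ α₁ α₂ α₃) ≡ y
  Ψt≡y = trans (Monomials.Ψ-param η₁ η₂ η₃ η₄ η₅ η₆ α₁ α₂ α₃) Ψℕ≡y
  bound : AllAbsLe (Ψ (param η₁ η₂ η₃ η₄ η₅ η₆ α₁ α₂ α₃)) B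
  bound = subst (λ z → AllAbsLe z B) (sym Ψt≡y) (maxAbs≤⇒AllAbsLe y (ℚ.≤-trans
    (maxAbs≤H-scale l y l≢0 (trans ∣l∣≡g (cong gcdAll x≡ly))) (subst (λ z → H z ≤ B) x≡ly H≤B)))
  1x≡x : map (1ℤ ℤ.*_) x ≡ x
  1x≡x = trans (map-cong ℤ.*-identityˡ x) (map-id x)

lemma4p1 : (B : ℚ) → 0ℚ < B →
  -- well-defined: Ψ maps 𝒯₁ into {x ∈ S°(ℚ) : H(x) ≤ B}
  ((t : Param) → InT1 B t → NonZeroVec (Ψ t) × InS° (Ψ t) × H (Ψ t) ≤ B)
  -- injective on projective points
  × ((t t′ : Param) → InT1 B t → InT1 B t′ → Ψ t ∼ Ψ t′ → t ≡ t′)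
  -- surjective onto {x ∈ S°(ℚ) : H(x) ≤ B}
  × ((x : Pt) → NonZeroVec x → InS° x → H x ≤ B →
       Σ Param (λ t → InT1 B t × Ψ t ∼ x))
lemma4p1 B _ = Ψ-well-defined , Ψ-injective , Ψ-surjective
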